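{- If $[\mathsf M,\eta]\neq0$ in $\mathcal M$ and $\partial_{\mathrm{del}}([\mathsf M,\eta])=0$, then $\mathsf M$ is simple.
   Context: A matroid is simple if it has no loops and no parallel elements (no circuits of size one or two). An orientation of $\mathsf M$ is a generator $\eta$ of $\bigwedge^{|E|}\mathbb{Z}\langle E\rangle$, $E=E(\mathsf M)$. $\mathcal M$ is the $\mathbb{Q}$-vector space spanned by symbols $[\mathsf M,\eta]$ modulo $[\mathsf M,-\eta]=-[\mathsf M,\eta]$ and $[\mathsf M,\eta]=[\mathsf M',\psi_*\eta]$ for every matroid isomorphism $\psi:\mathsf M\to\mathsf M'$ ($\psi_*$ the induced map on top exterior powers). With $\iota_x$ interior product ($\iota_x(x\wedge\alpha)=\alpha$), $\partial_{\mathrm{del}}[\mathsf M,\eta]=\sum_{x\in E,\ x\text{ not a coloop}}[\mathsf M\setminus x,\iota_x\eta]$. -}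

module Defs where

open import Data.Nat using (ℕ; zero; suc; _<_; _≟_)
open import Data.Bool using (Bool; true; false; _∧_; _∨_; not; if_then_else_)
open import Data.Fin using (Fin; toℕ; _<?_)
open import Data.Fin.Subset using (Subset; ⊥; ⁅_⁆; _∪_; _∈_; _∉_; _⊆_; _-_; ∣_∣)
open import Data.Fin.Permutation using (Permutation′; _⟨$⟩ʳ_; _⟨$⟩ˡ_)
open import Data.Vec using (Vec; []; _∷_; lookup; tabulate; insertAt)
open import Data.List using (List; []; _∷_; _++_; map; foldr; filter; concatMap; allFin; length)
open import Data.Sign using (Sign; opposite) renaming (_*_ to _*ₛ_; + to s+; - to s-)
open import Data.Rational using (ℚ; 0ℚ; 1ℚ; -_) renaming (_+_ to _+ℚ_; _*_ to _*ℚ_)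
open import Data.Product using (Σ; ∃; _×_; _,_; proj₁; proj₂)
open import Relation.Binary.PropositionalEquality using (_≡_; refl)
open import Relation.Nullary using (yes; no; ¬_)
open import Relation.Nullary.Decidable using (⌊_⌋)
open import Data.Bool.Properties using () renaming (_≟_ to _B≟_)

-- Matroids on the ground set Fin n, given by independent sets.
-- (Every finite matroid is isomorphic to one on Fin n; 𝓜 is defined up to
-- isomorphism, so this loses nothing.)

record Matroid (n : ℕ) : Set where
  field
    indep     : Subset n → Bool
    ind-empty : indep ⊥ ≡ true
    ind-down  : ∀ A B → A ⊆ B → indep B ≡ true → indep A ≡ true
    ind-aug   : ∀ A B → indep A ≡ true → indep B ≡ true → ∣ A ∣ < ∣ B ∣ →
                ∃ λ x → x ∈ B × x ∉ A × indep (⁅ x ⁆ ∪ A) ≡ true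
open Matroid public

Indep : ∀ {n} → Matroid n → Subset n → Set
Indep M S = indep M S ≡ true

IsCircuit : ∀ {n} → Matroid n → Subset n → Set
IsCircuit M C = ¬ Indep M C × (∀ x → x ∈ C → Indep M (C - x))

Simple : ∀ {n} → Matroid n → Set
Simple M = ∀ C → IsCircuit M C → 2 < ∣ C ∣

allSubsets : (n : ℕ) → List (Subset n)
allSubsets zero    = [] ∷ []
allSubsets (suc n) = map (true ∷_) (allSubsets n) ++ map (false ∷_) (allSubsets n)

allB : ∀ {A : Set} → (A → Bool) → List A → Bool
allB p = foldr (λ a b → p a ∧ b) true

_⊆ᵇ_ : ∀ {n} → Subset n → Subset n → Bool
[] ⊆ᵇ [] = true
(a ∷ as) ⊆ᵇ (b ∷ bs) = (not a ∨ b) ∧ (as ⊆ᵇ bs)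

isBasisᵇ : ∀ {n} → (Subset n → Bool) → Subset n → Bool
isBasisᵇ {n} f B = f B ∧ allB (λ A → not (B ⊆ᵇ A ∧ f A) ∨ (A ⊆ᵇ B)) (allSubsets n)

isColoopᵇ : ∀ {n} → (Subset n → Bool) → Fin n → Bool
isColoopᵇ {n} f x = allB (λ B → not (isBasisᵇ f B) ∨ lookup B x) (allSubsets n)

boolEq : Bool → Bool → Bool
boolEq true  true  = true
boolEq false false = true
boolEq _     _     = false

signEq : Sign → Sign → Bool
signEq s+ s+ = true
signEq s- s- = true
signEq _  _  = false

-- Orientations.  An orientation of a matroid on Fin n is ±(e₀∧…∧eₙ₋₁),
-- recorded by the Sign.

signPow : ℕ → Sign
signPow zero    = s+
signPow (suc k) = opposite (signPow k)

inversions : ∀ {n} → Permutation′ n → ℕ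
inversions {n} π =
  length (filter (λ p → proj₂ p <? proj₁ p)
    (concatMap (λ i → concatMap (λ j → if ⌊ i <? j ⌋ then (π ⟨$⟩ʳ i , π ⟨$⟩ʳ j) ∷ [] else [])
                                 (allFin n)) (allFin n)))

-- ψ_*(e₀∧…∧eₙ₋₁) = e_{ψ0}∧…∧e_{ψ(n-1)} = sgn(ψ)·(e₀∧…∧eₙ₋₁)
sgn : ∀ {n} → Permutation′ n → Sign
sgn π = signPow (inversions π)

image : ∀ {n} → Permutation′ n → Subset n → Subset n
image π S = tabulate (λ j → lookup S (π ⟨$⟩ˡ j))

IsIso : ∀ {n} → Matroid n → Matroid n → Permutation′ n → Set
IsIso M M' π = ∀ S → indep M' (image π S) ≡ indep M S

-- The space 𝓜 : formal ℚ-combinations of symbols [M, η] modulo relations.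
-- Keys record the (raw) independence function and the orientation sign.

Key : Set
Key = Σ ℕ λ n → (Subset n → Bool) × Sign

keyEq : Key → Key → Bool
keyEq (n , f , s) (m , g , t) with n ≟ m
... | no _ = false
... | yes refl = allB (λ S → boolEq (f S) (g S)) (allSubsets n) ∧ signEq s t

Comb : Set
Comb = List (ℚ × Key)

coeff : Comb → Key → ℚ
coeff v k = foldr (λ p acc → (if keyEq (proj₂ p) k then proj₁ p else 0ℚ) +ℚ acc) 0ℚ v

scale : ℚ → Comb → Comb
scale q = map (λ p → (q *ℚ proj₁ p , proj₂ p))

key : ∀ {n} → Matroid n → Sign → Key
key {n} M η = (n , indep M , η)

gen : ∀ {n} → Matroid n → Sign → Comb
gen M η = (1ℚ , key M η) ∷ []

data Rel : Set where
  negRel : ∀ {n} (M : Matroid n) (η : Sign) → Rel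
  isoRel : ∀ {n} (M M' : Matroid n) (ψ : Permutation′ n) → IsIso M M' ψ → (η : Sign) → Rel

relVec : Rel → Comb
relVec (negRel M η)         = (1ℚ , key M (opposite η)) ∷ (1ℚ , key M η) ∷ []
relVec (isoRel M M' ψ _ η)  = (1ℚ , key M η) ∷ (- 1ℚ , key M' (sgn ψ *ₛ η)) ∷ []

IsZero : Comb → Set
IsZero v = ∃ λ (rs : List (ℚ × Rel)) →
  ∀ k → coeff v k ≡ coeff (concatMap (λ p → scale (proj₁ p) (relVec (proj₂ p))) rs) k

-- Deletion.  Fin m is identified with Fin (suc m) ∖ {x} order-preservingly
-- (via punchIn x); ι_x(e₀∧…∧eₘ) = (-1)^x (e₀∧…ê_x…∧eₘ).

delIndep : ∀ {m} → Fin (suc m) → (Subset (suc m) → Bool) → Subset m → Bool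
delIndep x f S = f (insertAt S x false)

∂del : ∀ {n} → Matroid n → Sign → Comb
∂del {zero}  M η = []
∂del {suc m} M η =
  map (λ x → (1ℚ , (m , delIndep x (indep M) , signPow (toℕ x) *ₛ η)))
      (filter (λ x → not (isColoopᵇ (indep M) x) B≟ true) (allFin (suc m)))

{-# OPTIONS --safe #-}
-- A circuit of size at most two gives a parallel pair, two loops, or a unique loop ℓ. In the first
-- two cases the transposition of the two elements is an odd automorphism ψ of M, and the relations
-- [M, η] = [M, ψ_* η] = -[M, η] force [M, η] = 0. In the last case every automorphism of M ∖ ℓ
-- extends to one of M fixing ℓ, so M ∖ ℓ has no odd automorphism either, and "the coefficient of
-- [M ∖ ℓ]" is a well-defined linear functional on 𝓜. On ∂del [M, η] it only sees the summand
-- M ∖ ℓ, because every other M ∖ x still has the loop ℓ while M ∖ ℓ is loopless; that summand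
-- is ±1, so ∂del [M, η] ≠ 0.
module Submission where

open import Defs
import Algebra.Properties.CommutativeMonoid.Sum as CommutativeMonoidSum
import Algebra.Properties.Semiring.Sum as SemiringSum
import Data.Bool as Bool
open import Data.Bool using (Bool; true; false; not; _∧_; _∨_; if_then_else_)
open import Data.Bool.Properties using (⇔→≡; ¬-not; ∧-conicalˡ; ∧-conicalʳ)
open import Data.Empty using (⊥-elim)
open import Data.List.Extrema.Nat using (argmax; f[⊥]≤f[argmax]; f[xs]≤f[argmax])
import Data.List.Relation.Unary.All as All
import Data.Fin as Fin
open import Data.Fin using (Fin; zero; suc; toℕ; punchIn; punchOut)
open import Data.Fin.Subset using (Subset; ⊥; ⁅_⁆; _∪_; _∈_; _∉_; _⊆_; _-_; ∣_∣; Empty)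
open import Data.Fin.Subset.Properties
  using (x∈⁅x⁆; x∈⁅y⁆⇒x≡y; x∈p∪q⁻; x∈p∪q⁺; x∈p∧x≢y⇒x∈p-y; _∈?_; nonempty?; Empty-unique;
         anySubset?; x∈p⇒∣p-x∣<∣p∣; p⊂q⇒∣p∣<∣q∣; q⊆p∪q; ∣p∣≤∣x∷p∣; ∪-identityˡ; ⊆-trans; ⊆-antisym; p─q⊆p)
open import Data.Fin.Properties using (_≟_; _<?_; <-cmp; <-asym; <-irrefl; punchIn-punchOut; punchOut-punchIn; punchInᵢ≢i)
open import Data.Fin.Permutation
  using (Permutation′; _⟨$⟩ʳ_; _⟨$⟩ˡ_; _∘ₚ_; flip; inverseˡ; inverseʳ; transpose; lift₀; insert; remove; insert-remove; _≈_)
  renaming (id to idₚ)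
open import Data.List using (List; []; _∷_; _++_; map; foldr; length; filter; filterᵇ; concatMap; allFin)
open import Data.List.Membership.Propositional using (lose) renaming (_∈_ to _∈ₗ_)
open import Data.List.Membership.Propositional.Properties using (∈-map⁺; ∈-++⁺ˡ; ∈-++⁺ʳ; ∈-concatMap⁺; ∈-allFin)
open import Data.List.Relation.Unary.Any using (here; there; any?; satisfied)
import Data.List as List
open import Data.List.Properties using (length-++; filter-++; length-filter)
open import Data.Nat using (ℕ; zero; suc; _+_; _*_; _≤_; _<_; z≤n; s≤s)
import Data.Nat as ℕ
open import Data.Nat.Properties using (≟-diag; +-*-semiring; +-identityʳ; *-zeroʳ; *-distribˡ-+; ≤-refl; ≤-trans; ≤-<-trans; ≤-pred; <⇒≱; ≰⇒>; m≤n⇒m≤1+n)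
open import Data.Rational using (ℚ; 0ℚ; 1ℚ; ½; -_) renaming (_+_ to _+ℚ_; _*_ to _*ℚ_)
import Data.Rational.Properties as ℚ
open import Data.Rational.Solver using (module +-*-Solver)
open +-*-Solver using (solve; _:+_; _:*_; _:=_; con)
open import Data.Product using (∃; ∃₂; _×_; _,_; proj₁; proj₂)
open import Data.Sum using (_⊎_; inj₁; inj₂)
open import Data.Vec using (Vec; _∷_; lookup; tabulate; insertAt; removeAt) renaming ([] to []ᵥ; there to there⁻)
open import Data.Vec.Properties using (insertAt-lookup; insertAt-punchIn; insertAt-removeAt; removeAt-punchOut; lookup∘tabulate; tabulate-cong; tabulate∘lookup; []=⇒lookup; lookup⇒[]=)
open import Data.Sign using (Sign; opposite) renaming (+ to s+; - to s-; _*_ to _*ₛ_)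
import Data.Sign.Properties as Sign
open import Function using (_∘_; id; case_of_; mk⇔)
open import Relation.Binary using (tri<; tri≈; tri>)
open import Relation.Binary.PropositionalEquality
open import Relation.Nullary using (Dec; yes; no; does; ¬_)
open import Relation.Nullary.Decidable using (⌊_⌋; dec-true; dec-false; isYes≗does; map′; ¬?; _×-dec_; decidable-stable)
open import Relation.Unary using (Decidable)

module ∑ℕ = SemiringSum +-*-semiring
module ∑ℚ = CommutativeMonoidSum ℚ.+-0-commutativeMonoid
open ∑ℕ using (sum-syntax; sum-cong-≗)

χ : Bool → ℕ
χ true  = 1
χ false = 0

χ-split : ∀ b x → x ≡ χ b * x + χ (not b) * x
χ-split true  x = sym (trans (+-identityʳ (x + 0)) (+-identityʳ x))
χ-split false x = sym (+-identityʳ x)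

infix 4 _<ᵇ_

_<ᵇ_ : ∀ {n} → Fin n → Fin n → Bool
i <ᵇ j = does (i <? j)

<ᵇ-irrefl : ∀ {n} (i : Fin n) → (i <ᵇ i) ≡ false
<ᵇ-irrefl i = dec-false (i <? i) (<-irrefl refl)

<ᵇ-flip : ∀ {n} {i j : Fin n} → i ≢ j → (j <ᵇ i) ≡ not (i <ᵇ j)
<ᵇ-flip {i = i} {j} i≢j with <-cmp i j
... | tri< i<j _ _ rewrite dec-false (j <? i) (<-asym i<j) | dec-true (i <? j) i<j = refl
... | tri≈ _ i≡j _ = ⊥-elim (i≢j i≡j)
... | tri> _ _ j<i rewrite dec-true (j <? i) j<i | dec-false (i <? j) (<-asym j<i) = refl

<ᵇ⇒≢ : ∀ {n} {i j : Fin n} → (i <ᵇ j) ≡ true → i ≢ j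
<ᵇ⇒≢ {i = i} i<j refl with () ← trans (sym i<j) (<ᵇ-irrefl i)

∑∑ : ∀ {n} → (Fin n → Fin n → ℕ) → ℕ
∑∑ {n} F = ∑[ i < n ] ∑[ j < n ] F i j

module _ {n : ℕ} where

  ∑∑-cong : ∀ {F G : Fin n → Fin n → ℕ} → (∀ i j → F i j ≡ G i j) → ∑∑ F ≡ ∑∑ G
  ∑∑-cong F≗G = sum-cong-≗ (sum-cong-≗ ∘ F≗G)

  ∑∑-distrib-+ : ∀ (F G : Fin n → Fin n → ℕ) → ∑∑ (λ i j → F i j + G i j) ≡ ∑∑ F + ∑∑ G
  ∑∑-distrib-+ F G = trans (sum-cong-≗ λ i → ∑ℕ.∑-distrib-+ (F i) (G i))
                           (∑ℕ.∑-distrib-+ (λ i → ∑[ j < n ] F i j) (λ i → ∑[ j < n ] G i j))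

  ∑∑-*-distribˡ : ∀ c (F : Fin n → Fin n → ℕ) → ∑∑ (λ i j → c * F i j) ≡ c * ∑∑ F
  ∑∑-*-distribˡ c F = sym (trans (∑ℕ.*-distribˡ-sum c (λ i → ∑[ j < n ] F i j))
                                 (sum-cong-≗ λ i → ∑ℕ.*-distribˡ-sum c (F i)))

  ∑∑-comm : ∀ (F : Fin n → Fin n → ℕ) → ∑∑ F ≡ ∑∑ (λ i j → F j i)
  ∑∑-comm = ∑ℕ.∑-comm

  ∑∑-permute : ∀ (π : Permutation′ n) (F : Fin n → Fin n → ℕ) →
               ∑∑ F ≡ ∑∑ (λ i j → F (π ⟨$⟩ʳ i) (π ⟨$⟩ʳ j))
  ∑∑-permute π F = trans (∑ℕ.∑-permute (λ i → ∑[ j < n ] F i j) π)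
                         (sum-cong-≗ λ i → ∑ℕ.∑-permute (F (π ⟨$⟩ʳ i)) π)

  ∑∑-symmetrize : ∀ (F : Fin n → Fin n → ℕ) → (∀ i → F i i ≡ 0) →
                  ∑∑ F ≡ ∑∑ (λ i j → χ (i <ᵇ j) * (F i j + F j i))
  ∑∑-symmetrize F diag = begin
    ∑∑ F                                                  ≡⟨ ∑∑-cong split ⟩
    ∑∑ (λ i j → χ (i <ᵇ j) * F i j + χ (j <ᵇ i) * F i j)  ≡⟨ ∑∑-distrib-+ _ _ ⟩
    ∑∑ (λ i j → χ (i <ᵇ j) * F i j) + ∑∑ (λ i j → χ (j <ᵇ i) * F i j)
      ≡⟨ cong (∑∑ (λ i j → χ (i <ᵇ j) * F i j) +_) (∑∑-comm _) ⟩
    ∑∑ (λ i j → χ (i <ᵇ j) * F i j) + ∑∑ (λ i j → χ (i <ᵇ j) * F j i)  ≡⟨ ∑∑-distrib-+ _ _ ⟨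
    ∑∑ (λ i j → χ (i <ᵇ j) * F i j + χ (i <ᵇ j) * F j i)
      ≡⟨ ∑∑-cong (λ i j → sym (*-distribˡ-+ (χ (i <ᵇ j)) (F i j) (F j i))) ⟩
    ∑∑ (λ i j → χ (i <ᵇ j) * (F i j + F j i))             ∎
    where
    open ≡-Reasoning
    split : ∀ i j → F i j ≡ χ (i <ᵇ j) * F i j + χ (j <ᵇ i) * F i j
    split i j with i ≟ j
    ... | yes refl rewrite <ᵇ-irrefl i = diag i
    ... | no i≢j rewrite <ᵇ-flip i≢j = χ-split (i <ᵇ j) (F i j)

inversionCount : ∀ {n} → (Fin n → Fin n) → ℕ
inversionCount p = ∑∑ λ i j → χ (i <ᵇ j) * χ (p j <ᵇ p i)

length-filter-concatMap : ∀ {A B : Set} {P : B → Set} (P? : Decidable P) (h : A → List B) {k}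
                          (t : Fin k → A) →
  length (filter P? (concatMap h (List.tabulate t))) ≡ ∑[ x < k ] length (filter P? (h (t x)))
length-filter-concatMap P? h {zero}  t = refl
length-filter-concatMap P? h {suc k} t = begin
  length (filter P? (h (t zero) List.++ concatMap h (List.tabulate (t ∘ suc))))
    ≡⟨ cong length (filter-++ P? (h (t zero)) _) ⟩
  length (filter P? (h (t zero)) List.++ filter P? (concatMap h (List.tabulate (t ∘ suc))))
    ≡⟨ length-++ (filter P? (h (t zero))) ⟩
  length (filter P? (h (t zero))) + length (filter P? (concatMap h (List.tabulate (t ∘ suc))))
    ≡⟨ cong (length (filter P? (h (t zero))) +_) (length-filter-concatMap P? h (t ∘ suc)) ⟩
  ∑[ x < suc k ] length (filter P? (h (t x)))  ∎
  where open ≡-Reasoning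

length-filter-if : ∀ {B : Set} {P : B → Set} (P? : Decidable P) b (x : B) →
                   length (filter P? (if b then x ∷ [] else [])) ≡ χ b * χ (does (P? x))
length-filter-if P? false x = refl
length-filter-if P? true  x with does (P? x)
... | true  = refl
... | false = refl

inversions≡inversionCount : ∀ {n} (π : Permutation′ n) → inversions π ≡ inversionCount (π ⟨$⟩ʳ_)
inversions≡inversionCount {n} π =
  trans (length-filter-concatMap P? (λ i → concatMap (pairs i) (allFin n)) id)
        (sum-cong-≗ λ i → trans (length-filter-concatMap P? (pairs i) id)
                                (sum-cong-≗ λ j → pair-count i j))
  where
  P? : Decidable (λ (p : Fin n × Fin n) → proj₂ p Fin.< proj₁ p)
  P? p = proj₂ p <? proj₁ p
  pairs : Fin n → Fin n → List (Fin n × Fin n)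
  pairs i j = if ⌊ i <? j ⌋ then (π ⟨$⟩ʳ i , π ⟨$⟩ʳ j) ∷ [] else []
  pair-count : ∀ i j → length (filter P? (pairs i j)) ≡ χ (i <ᵇ j) * χ (π ⟨$⟩ʳ j <ᵇ π ⟨$⟩ʳ i)
  pair-count i j rewrite isYes≗does (i <? j) = length-filter-if P? (i <ᵇ j) _

pair-parity : ∀ (l l′ p p′ q q′ : Bool) → (l ≡ true → l′ ≡ false × p′ ≡ not p × q′ ≡ not q) →
  χ l * ((χ p * χ q + χ l * χ q) + (χ p′ * χ q′ + χ l′ * χ q′))
    ≡ χ l * (χ p * χ l′ + χ p′ * χ l) + 2 * (χ l * (χ p * χ q))
pair-parity false _ _ _ _ _ _ = refl
pair-parity true  _ p _ q _ h with h refl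
... | refl , refl , refl with p | q
... | true  | true  = refl
... | true  | false = refl
... | false | true  = refl
... | false | false = refl

inversions-reindex : ∀ {n} (π : Permutation′ n) (R : Fin n → Fin n → Bool) →
  ∑∑ (λ i j → χ (i <ᵇ j) * χ (R (π ⟨$⟩ʳ j) (π ⟨$⟩ʳ i))) ≡ ∑∑ (λ a b → χ (π ⟨$⟩ˡ a <ᵇ π ⟨$⟩ˡ b) * χ (R b a))
inversions-reindex π R = trans (∑∑-permute (flip π) _)
  (∑∑-cong λ a b → cong₂ (λ x y → χ (π ⟨$⟩ˡ a <ᵇ π ⟨$⟩ˡ b) * χ (R x y)) (inverseʳ π) (inverseʳ π))

-- After reindexing by π⁻¹, symmetrizing over the pairs {a, b} reduces the claim to pair-parity.
inversionCount-∘ : ∀ {n} (π σ : Permutation′ n) → ∃ λ k →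
  inversionCount ((π ∘ₚ σ) ⟨$⟩ʳ_) + inversionCount (σ ⟨$⟩ʳ_) ≡ inversionCount (π ⟨$⟩ʳ_) + 2 * k
inversionCount-∘ {n} π σ = K , (begin
    inversionCount ((π ∘ₚ σ) ⟨$⟩ʳ_) + inversionCount (σ ⟨$⟩ʳ_)
  ≡⟨ cong (_+ inversionCount (σ ⟨$⟩ʳ_)) (inversions-reindex π (λ x y → σ ⟨$⟩ʳ x <ᵇ σ ⟨$⟩ʳ y)) ⟩
    ∑∑ (λ a b → P a b * Q a b) + ∑∑ (λ a b → L a b * Q a b)
  ≡⟨ ∑∑-distrib-+ (λ a b → P a b * Q a b) (λ a b → L a b * Q a b) ⟨
    ∑∑ T
  ≡⟨ ∑∑-symmetrize T T-diag ⟩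
    ∑∑ (λ a b → L a b * (T a b + T b a))
  ≡⟨ ∑∑-cong pointwise ⟩
    ∑∑ (λ a b → L a b * (U a b + U b a) + 2 * (L a b * (P a b * Q a b)))
  ≡⟨ ∑∑-distrib-+ (λ a b → L a b * (U a b + U b a)) (λ a b → 2 * (L a b * (P a b * Q a b))) ⟩
    ∑∑ (λ a b → L a b * (U a b + U b a)) + ∑∑ (λ a b → 2 * (L a b * (P a b * Q a b)))
  ≡⟨ cong₂ _+_ (∑∑-symmetrize U U-diag) (sym (∑∑-*-distribˡ 2 (λ a b → L a b * (P a b * Q a b)))) ⟨
    ∑∑ U + 2 * K
  ≡⟨ cong (_+ 2 * K) (inversions-reindex π _<ᵇ_) ⟨
    inversionCount (π ⟨$⟩ʳ_) + 2 * K  ∎)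
  where
  open ≡-Reasoning
  πˡ : Fin n → Fin n
  πˡ = π ⟨$⟩ˡ_
  L P Q T U : Fin n → Fin n → ℕ
  L a b = χ (a <ᵇ b)
  P a b = χ (πˡ a <ᵇ πˡ b)
  Q a b = χ (σ ⟨$⟩ʳ b <ᵇ σ ⟨$⟩ʳ a)
  T a b = P a b * Q a b + L a b * Q a b
  U a b = P a b * L b a
  K : ℕ
  K = ∑∑ (λ a b → L a b * (P a b * Q a b))
  T-diag : ∀ a → T a a ≡ 0
  T-diag a rewrite <ᵇ-irrefl a | <ᵇ-irrefl (πˡ a) = refl
  U-diag : ∀ a → U a a ≡ 0
  U-diag a rewrite <ᵇ-irrefl (πˡ a) = refl
  pointwise : ∀ a b → L a b * (T a b + T b a) ≡ L a b * (U a b + U b a) + 2 * (L a b * (P a b * Q a b))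
  pointwise a b = pair-parity (a <ᵇ b) (b <ᵇ a) (πˡ a <ᵇ πˡ b) (πˡ b <ᵇ πˡ a)
                              (σ ⟨$⟩ʳ b <ᵇ σ ⟨$⟩ʳ a) (σ ⟨$⟩ʳ a <ᵇ σ ⟨$⟩ʳ b) λ a<b →
    let a≢b = <ᵇ⇒≢ a<b in
    trans (<ᵇ-flip a≢b) (cong not a<b) ,
    <ᵇ-flip (a≢b ∘ injectiveˡ) ,
    <ᵇ-flip (a≢b ∘ sym ∘ injectiveʳ)
    where
    injectiveˡ : πˡ a ≡ πˡ b → a ≡ b
    injectiveˡ e = trans (sym (inverseʳ π)) (trans (cong (π ⟨$⟩ʳ_) e) (inverseʳ π))
    injectiveʳ : σ ⟨$⟩ʳ b ≡ σ ⟨$⟩ʳ a → b ≡ a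
    injectiveʳ e = trans (sym (inverseˡ σ)) (trans (cong (σ ⟨$⟩ˡ_) e) (inverseˡ σ))

signPow-+ : ∀ a b → signPow (a + b) ≡ signPow a *ₛ signPow b
signPow-+ zero    b = refl
signPow-+ (suc a) b = trans (cong opposite (signPow-+ a b)) (opposite-*ₛ (signPow a))
  where
  opposite-*ₛ : ∀ x {y} → opposite (x *ₛ y) ≡ opposite x *ₛ y
  opposite-*ₛ s+ = refl
  opposite-*ₛ s- = Sign.opposite-involutive _

signPow-2* : ∀ k → signPow (2 * k) ≡ s+
signPow-2* k = begin
  signPow (k + (k + 0))         ≡⟨ cong (λ m → signPow (k + m)) (+-identityʳ k) ⟩
  signPow (k + k)               ≡⟨ signPow-+ k k ⟩
  signPow k *ₛ signPow k        ≡⟨ Sign.s*s≡+ (signPow k) ⟩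
  s+                            ∎
  where open ≡-Reasoning

*ₛ-moveʳ : ∀ x y {z} → x *ₛ y ≡ z → x ≡ z *ₛ y
*ₛ-moveʳ s+ s+ refl = refl
*ₛ-moveʳ s+ s- refl = refl
*ₛ-moveʳ s- s+ refl = refl
*ₛ-moveʳ s- s- refl = refl

sgn≡signPow-inversionCount : ∀ {n} (π : Permutation′ n) → sgn π ≡ signPow (inversionCount (π ⟨$⟩ʳ_))
sgn≡signPow-inversionCount π = cong signPow (inversions≡inversionCount π)

sgn-∘ : ∀ {n} (π σ : Permutation′ n) → sgn (π ∘ₚ σ) ≡ sgn π *ₛ sgn σ
sgn-∘ π σ with inversionCount-∘ π σ
... | k , parity = begin
  sgn (π ∘ₚ σ)                          ≡⟨ sgn≡signPow-inversionCount (π ∘ₚ σ) ⟩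
  signPow c                             ≡⟨ *ₛ-moveʳ (signPow c) (signPow s) (begin
      signPow c *ₛ signPow s            ≡⟨ signPow-+ c s ⟨
      signPow (c + s)                   ≡⟨ cong signPow parity ⟩
      signPow (p + 2 * k)               ≡⟨ signPow-+ p (2 * k) ⟩
      signPow p *ₛ signPow (2 * k)      ≡⟨ cong (signPow p *ₛ_) (signPow-2* k) ⟩
      signPow p *ₛ s+                   ≡⟨ Sign.*-identityʳ (signPow p) ⟩
      signPow p                         ∎) ⟩
  signPow p *ₛ signPow s                ≡⟨ cong₂ _*ₛ_ (sgn≡signPow-inversionCount π) (sgn≡signPow-inversionCount σ) ⟨
  sgn π *ₛ sgn σ                        ∎
  where
  open ≡-Reasoning
  c s p : ℕ
  c = inversionCount ((π ∘ₚ σ) ⟨$⟩ʳ_)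
  s = inversionCount (σ ⟨$⟩ʳ_)
  p = inversionCount (π ⟨$⟩ʳ_)

sgn-≈ : ∀ {n} {π ρ : Permutation′ n} → π ≈ ρ → sgn π ≡ sgn ρ
sgn-≈ {π = π} {ρ} π≈ρ = begin
  sgn π                                     ≡⟨ sgn≡signPow-inversionCount π ⟩
  signPow (inversionCount (π ⟨$⟩ʳ_))        ≡⟨ cong signPow (∑∑-cong λ i j → cong₂ (λ x y → χ (i <ᵇ j) * χ (x <ᵇ y)) (π≈ρ j) (π≈ρ i)) ⟩
  signPow (inversionCount (ρ ⟨$⟩ʳ_))        ≡⟨ sgn≡signPow-inversionCount ρ ⟨
  sgn ρ                                     ∎
  where open ≡-Reasoning

∑-zero : ∀ {n} (f : Fin n → ℕ) → (∀ i → f i ≡ 0) → ∑[ i < n ] f i ≡ 0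
∑-zero {n} f f≡0 = trans (sum-cong-≗ {n} f≡0) (∑ℕ.sum-replicate-zero n)

χ-<ᵇ-asym : ∀ {n} (i j : Fin n) → χ (i <ᵇ j) * χ (j <ᵇ i) ≡ 0
χ-<ᵇ-asym i j with i ≟ j
... | yes refl rewrite <ᵇ-irrefl i = refl
... | no i≢j rewrite <ᵇ-flip i≢j with i <ᵇ j
...   | true  = refl
...   | false = refl

sgn-id : ∀ {n} → sgn (idₚ {n}) ≡ s+
sgn-id {n} = trans (sgn≡signPow-inversionCount (idₚ {n}))
                   (cong signPow (∑-zero {n} _ λ i → ∑-zero {n} _ (χ-<ᵇ-asym i)))

sgn-flip : ∀ {n} (π : Permutation′ n) → sgn (flip π) ≡ sgn π
sgn-flip {n} π = sym (*ₛ-moveʳ (sgn π) (sgn (flip π)) (begin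
  sgn π *ₛ sgn (flip π)     ≡⟨ sgn-∘ π (flip π) ⟨
  sgn (π ∘ₚ flip π)         ≡⟨ sgn-≈ {π = π ∘ₚ flip π} {idₚ} (λ _ → inverseˡ π) ⟩
  sgn (idₚ {n})             ≡⟨ sgn-id {n} ⟩
  s+                        ∎))
  where open ≡-Reasoning

-- Past row 0, which has no inversion, the count for lift₀ σ is definitionally that of σ.
sgn-lift₀ : ∀ {n} (σ : Permutation′ n) → sgn (lift₀ σ) ≡ sgn σ
sgn-lift₀ {n} σ = begin
  sgn (lift₀ σ)                                   ≡⟨ sgn≡signPow-inversionCount (lift₀ σ) ⟩
  signPow (inversionCount (lift₀ σ ⟨$⟩ʳ_))        ≡⟨ cong (λ z → signPow (z + inversionCount (σ ⟨$⟩ʳ_))) first-row ⟩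
  signPow (inversionCount (σ ⟨$⟩ʳ_))              ≡⟨ sgn≡signPow-inversionCount σ ⟨
  sgn σ                                           ∎
  where
  open ≡-Reasoning
  first-row : ∑[ j < suc n ] (χ (zero <ᵇ j) * χ (lift₀ σ ⟨$⟩ʳ j <ᵇ zero)) ≡ 0
  first-row = ∑-zero {suc n} _ λ j → *-zeroʳ (χ (zero <ᵇ j))

-- The only inversion of transpose 0 1 is the pair (0, 1).
sgn-transpose₀₁ : ∀ {n} → sgn (transpose {suc (suc n)} zero (suc zero)) ≡ s-
sgn-transpose₀₁ {n} = trans (sgn≡signPow-inversionCount t) (cong signPow count)
  where
  t : Permutation′ (suc (suc n))
  t = transpose zero (suc zero)
  count : inversionCount (t ⟨$⟩ʳ_) ≡ 1
  count = cong₂ _+_ (cong suc (∑-zero {n} _ λ _ → refl))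
            (cong₂ _+_ (∑-zero {suc (suc n)} _ λ j → *-zeroʳ (χ (suc zero <ᵇ j)))
                       (∑-zero {n} _ λ i → ∑-zero {n} _ λ j → χ-<ᵇ-asym i j))

conjugate : ∀ {n} → Permutation′ n → Permutation′ n → Permutation′ n
conjugate ρ τ = flip ρ ∘ₚ (τ ∘ₚ ρ)

sgn-conjugate : ∀ {n} (ρ τ : Permutation′ n) → sgn (conjugate ρ τ) ≡ sgn τ
sgn-conjugate ρ τ = begin
  sgn (flip ρ ∘ₚ (τ ∘ₚ ρ))          ≡⟨ sgn-∘ (flip ρ) (τ ∘ₚ ρ) ⟩
  sgn (flip ρ) *ₛ sgn (τ ∘ₚ ρ)      ≡⟨ cong₂ _*ₛ_ (sgn-flip ρ) (sgn-∘ τ ρ) ⟩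
  sgn ρ *ₛ (sgn τ *ₛ sgn ρ)         ≡⟨ cancel (sgn ρ) (sgn τ) ⟩
  sgn τ                             ∎
  where
  open ≡-Reasoning
  cancel : ∀ r t → r *ₛ (t *ₛ r) ≡ t
  cancel s+ t  = Sign.*-identityʳ t
  cancel s- s+ = refl
  cancel s- s- = refl

conjugate-ˡ : ∀ {n} (ρ τ : Permutation′ n) c → conjugate ρ τ ⟨$⟩ˡ (ρ ⟨$⟩ʳ c) ≡ ρ ⟨$⟩ʳ (τ ⟨$⟩ˡ c)
conjugate-ˡ ρ τ c = cong (λ x → ρ ⟨$⟩ʳ (τ ⟨$⟩ˡ x)) (inverseˡ ρ)

⁅⁆-⊆ : ∀ {n} {x : Fin n} {p} → x ∈ p → ⁅ x ⁆ ⊆ p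
⁅⁆-⊆ {x = x} x∈p y∈⁅x⁆ = subst (_∈ _) (sym (x∈⁅y⁆⇒x≡y x y∈⁅x⁆)) x∈p

⁅⁆∪-⊆ : ∀ {n} {x : Fin n} {p q} → x ∈ q → p ⊆ q → ⁅ x ⁆ ∪ p ⊆ q
⁅⁆∪-⊆ {x = x} {p} x∈q p⊆q y∈ with x∈p∪q⁻ ⁅ x ⁆ p y∈
... | inj₁ y∈⁅x⁆ = ⁅⁆-⊆ x∈q y∈⁅x⁆
... | inj₂ y∈p   = p⊆q y∈p

∪-mono : ∀ {n} {p p′ q q′ : Subset n} → p ⊆ p′ → q ⊆ q′ → p ∪ q ⊆ p′ ∪ q′
∪-mono {p = p} {q = q} p⊆p′ q⊆q′ x∈ with x∈p∪q⁻ p q x∈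
... | inj₁ x∈p = x∈p∪q⁺ (inj₁ (p⊆p′ x∈p))
... | inj₂ x∈q = x∈p∪q⁺ (inj₂ (q⊆q′ x∈q))

x∈p-y⇒x∈p : ∀ {n} {p : Subset n} {x y} → x ∈ p - y → x ∈ p
x∈p-y⇒x∈p {p = p} {y = y} = p─q⊆p p ⁅ y ⁆

x∉p-x : ∀ {n} (p : Subset n) x → x ∉ p - x
x∉p-x (s ∷ p) zero    ()
x∉p-x (s ∷ p) (suc x) (there⁻ x∈p-x) = x∉p-x p x x∈p-x

x∈p-y⇒x≢y : ∀ {n} {p : Subset n} {x y} → x ∈ p - y → x ≢ y
x∈p-y⇒x≢y {p = p} {x} x∈p-x refl = x∉p-x p x x∈p-x

p⊆⁅x⁆∪p-x : ∀ {n} (p : Subset n) x → p ⊆ ⁅ x ⁆ ∪ (p - x)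
p⊆⁅x⁆∪p-x p x {y} y∈p with y ≟ x
... | yes refl = x∈p∪q⁺ (inj₁ (x∈⁅x⁆ y))
... | no y≢x   = x∈p∪q⁺ (inj₂ (x∈p∧x≢y⇒x∈p-y y∈p y≢x))

Empty[p-x]⇒p⊆⁅x⁆ : ∀ {n} {p : Subset n} {x} → Empty (p - x) → p ⊆ ⁅ x ⁆
Empty[p-x]⇒p⊆⁅x⁆ {p = p} {x} p-x-empty y∈p with x∈p∪q⁻ ⁅ x ⁆ (p - x) (p⊆⁅x⁆∪p-x p x y∈p)
... | inj₁ y∈⁅x⁆ = y∈⁅x⁆
... | inj₂ y∈p-x = ⊥-elim (p-x-empty (_ , y∈p-x))

∣⁅x⁆∪p∣≤1+∣p∣ : ∀ {n} (x : Fin n) (p : Subset n) → ∣ ⁅ x ⁆ ∪ p ∣ ≤ suc ∣ p ∣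
∣⁅x⁆∪p∣≤1+∣p∣ zero    (s ∷ p) = s≤s (subst (_≤ ∣ s ∷ p ∣) (sym (cong ∣_∣ (∪-identityˡ p))) (∣p∣≤∣x∷p∣ s p))
∣⁅x⁆∪p∣≤1+∣p∣ (suc x) (true  ∷ p) = s≤s (∣⁅x⁆∪p∣≤1+∣p∣ x p)
∣⁅x⁆∪p∣≤1+∣p∣ (suc x) (false ∷ p) = ∣⁅x⁆∪p∣≤1+∣p∣ x p

x∉p⇒∣p∣<∣⁅x⁆∪p∣ : ∀ {n} {x : Fin n} {p} → x ∉ p → ∣ p ∣ < ∣ ⁅ x ⁆ ∪ p ∣
x∉p⇒∣p∣<∣⁅x⁆∪p∣ {x = x} {p} x∉p = p⊂q⇒∣p∣<∣q∣ (q⊆p∪q ⁅ x ⁆ p , x , x∈p∪q⁺ (inj₁ (x∈⁅x⁆ x)) , x∉p)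

module _ {n : ℕ} (ψ : Permutation′ n) {S : Subset n} {x : Fin n} where

  ∈-image⁺ : ψ ⟨$⟩ˡ x ∈ S → x ∈ image ψ S
  ∈-image⁺ ψx∈S = lookup⇒[]= x (image ψ S) (trans (lookup∘tabulate _ x) ([]=⇒lookup ψx∈S))

  ∈-image⁻ : x ∈ image ψ S → ψ ⟨$⟩ˡ x ∈ S
  ∈-image⁻ x∈ψS = lookup⇒[]= (ψ ⟨$⟩ˡ x) S (trans (sym (lookup∘tabulate _ x)) ([]=⇒lookup x∈ψS))

module _ {n : ℕ} where

  image-id : ∀ (S : Subset n) → image idₚ S ≡ S
  image-id = tabulate∘lookup

  image-∘ : ∀ (π ψ : Permutation′ n) S → image (π ∘ₚ ψ) S ≡ image ψ (image π S)
  image-∘ π ψ S = sym (tabulate-cong λ j → lookup∘tabulate _ (ψ ⟨$⟩ˡ j))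

  image-flip : ∀ (ψ : Permutation′ n) S → image ψ (image (flip ψ) S) ≡ S
  image-flip ψ S = trans (tabulate-cong λ j → trans (lookup∘tabulate _ (ψ ⟨$⟩ˡ j)) (cong (lookup S) (inverseʳ ψ)))
                         (tabulate∘lookup S)

  image-≈ : ∀ {π π′ : Permutation′ n} → π ≈ π′ → ∀ S → image π S ≡ image π′ S
  image-≈ {π} {π′} π≈π′ S = tabulate-cong λ j → cong (lookup S) (begin
    π ⟨$⟩ˡ j                           ≡⟨ inverseˡ π′ ⟨
    π′ ⟨$⟩ˡ (π′ ⟨$⟩ʳ (π ⟨$⟩ˡ j))         ≡⟨ cong (π′ ⟨$⟩ˡ_) (π≈π′ (π ⟨$⟩ˡ j)) ⟨
    π′ ⟨$⟩ˡ (π ⟨$⟩ʳ (π ⟨$⟩ˡ j))          ≡⟨ cong (π′ ⟨$⟩ˡ_) (inverseʳ π) ⟩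
    π′ ⟨$⟩ˡ j                          ∎)
    where open ≡-Reasoning

image-⁅⁆ : ∀ {n} (π : Permutation′ n) y → image π ⁅ y ⁆ ≡ ⁅ π ⟨$⟩ʳ y ⁆
image-⁅⁆ π y = ⊆-antisym
  (λ {j} j∈ → subst (_∈ ⁅ π ⟨$⟩ʳ y ⁆)
                    (trans (cong (π ⟨$⟩ʳ_) (sym (x∈⁅y⁆⇒x≡y y (∈-image⁻ π j∈)))) (inverseʳ π))
                    (x∈⁅x⁆ (π ⟨$⟩ʳ y)))
  (λ {j} j∈ → ∈-image⁺ π (subst (_∈ ⁅ y ⁆)
                    (trans (sym (inverseˡ π)) (cong (π ⟨$⟩ˡ_) (sym (x∈⁅y⁆⇒x≡y _ j∈))))
                    (x∈⁅x⁆ y)))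

-- IsIso M M′ π is definitionally indep M ≅⟨ π ⟩ indep M′.
infix 4 _≅⟨_⟩_
_≅⟨_⟩_ : ∀ {n} → (Subset n → Bool) → Permutation′ n → (Subset n → Bool) → Set
f ≅⟨ π ⟩ f′ = ∀ S → f′ (image π S) ≡ f S

module _ {n : ℕ} {f f′ : Subset n → Bool} where

  ≅-refl : (∀ S → f S ≡ f′ S) → f ≅⟨ idₚ ⟩ f′
  ≅-refl f≗f′ S = trans (cong f′ (image-id S)) (sym (f≗f′ S))

  ≅-sym : ∀ {π} → f ≅⟨ π ⟩ f′ → f′ ≅⟨ flip π ⟩ f
  ≅-sym {π} f≅f′ S = trans (sym (f≅f′ (image (flip π) S))) (cong f′ (image-flip π S))

  ≅-≈ : ∀ {π π′} → π ≈ π′ → f ≅⟨ π ⟩ f′ → f ≅⟨ π′ ⟩ f′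
  ≅-≈ {π} {π′} π≈π′ f≅f′ S = trans (cong f′ (sym (image-≈ {π = π} {π′} π≈π′ S))) (f≅f′ S)

  ≅-trans : ∀ {f″ π ψ} → f ≅⟨ π ⟩ f′ → f′ ≅⟨ ψ ⟩ f″ → f ≅⟨ π ∘ₚ ψ ⟩ f″
  ≅-trans {f″} {π} {ψ} f≅f′ f′≅f″ S =
    trans (cong f″ (image-∘ π ψ S)) (trans (f′≅f″ (image π S)) (f≅f′ S))

NoOddAutomorphism : ∀ {n} → (Subset n → Bool) → Set
NoOddAutomorphism f = ∀ ψ → f ≅⟨ ψ ⟩ f → sgn ψ ≡ s+

≅-sgn-unique : ∀ {n} {f g : Subset n → Bool} → NoOddAutomorphism g →
               ∀ {π π′ : Permutation′ n} → f ≅⟨ π ⟩ g → f ≅⟨ π′ ⟩ g → sgn π ≡ sgn π′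
≅-sgn-unique {f = f} {g} no-odd {π} {π′} f≅g f≅′g = *ₛ-moveʳ (sgn π) (sgn π′) (begin
  sgn π *ₛ sgn π′            ≡⟨ cong (_*ₛ sgn π′) (sgn-flip π) ⟨
  sgn (flip π) *ₛ sgn π′     ≡⟨ sgn-∘ (flip π) π′ ⟨
  sgn (flip π ∘ₚ π′)         ≡⟨ no-odd (flip π ∘ₚ π′) (≅-trans {f = g} {f′ = f} {f″ = g} {flip π} {π′} (≅-sym {π = π} f≅g) f≅′g) ⟩
  s+                         ∎)
  where open ≡-Reasoning

record IsSwap {n} (ψ : Permutation′ n) (a b : Fin n) : Set where
  field
    sends-a      : ψ ⟨$⟩ˡ a ≡ b
    sends-b      : ψ ⟨$⟩ˡ b ≡ a
    fixes-others : ∀ {j} → j ≢ a → j ≢ b → ψ ⟨$⟩ˡ j ≡ j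

IsSwap-sym : ∀ {n} {ψ : Permutation′ n} {a b} → IsSwap ψ a b → IsSwap ψ b a
IsSwap-sym swap = record
  { sends-a = sends-b ; sends-b = sends-a ; fixes-others = λ j≢b j≢a → fixes-others j≢a j≢b }
  where open IsSwap swap

conjugate-transpose₀₁ : ∀ {n} (ρ : Permutation′ (suc (suc n))) →
  IsSwap (conjugate ρ (transpose zero (suc zero))) (ρ ⟨$⟩ʳ zero) (ρ ⟨$⟩ʳ suc zero)
conjugate-transpose₀₁ {n} ρ = record
  { sends-a      = conjugate-ˡ ρ t zero
  ; sends-b      = conjugate-ˡ ρ t (suc zero)
  ; fixes-others = λ {j} j≢a j≢b → trans (cong (ψ ⟨$⟩ˡ_) (sym (inverseʳ ρ))) (fixes j≢a j≢b (ρ ⟨$⟩ˡ j) refl)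
  }
  where
  t ψ : Permutation′ (suc (suc n))
  t = transpose zero (suc zero)
  ψ = conjugate ρ t
  fixes : ∀ {j} → j ≢ ρ ⟨$⟩ʳ zero → j ≢ ρ ⟨$⟩ʳ suc zero → ∀ c → ρ ⟨$⟩ˡ j ≡ c → ψ ⟨$⟩ˡ (ρ ⟨$⟩ʳ c) ≡ j
  fixes j≢a j≢b zero          ρj≡c = ⊥-elim (j≢a (trans (sym (inverseʳ ρ)) (cong (ρ ⟨$⟩ʳ_) ρj≡c)))
  fixes j≢a j≢b (suc zero)    ρj≡c = ⊥-elim (j≢b (trans (sym (inverseʳ ρ)) (cong (ρ ⟨$⟩ʳ_) ρj≡c)))
  fixes j≢a j≢b (suc (suc c)) ρj≡c = trans (conjugate-ˡ ρ t (suc (suc c))) (trans (cong (ρ ⟨$⟩ʳ_) (sym ρj≡c)) (inverseʳ ρ))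

odd-swap : ∀ {n} {a b : Fin n} → a ≢ b → ∃ λ ψ → IsSwap ψ a b × sgn ψ ≡ s-
odd-swap {suc zero} {zero} {zero} a≢b = ⊥-elim (a≢b refl)
odd-swap {suc (suc n)} {a} {b} a≢b =
  conjugate ρ (transpose zero (suc zero)) ,
  subst (IsSwap _ a) (punchIn-punchOut a≢b) (conjugate-transpose₀₁ ρ) ,
  trans (sgn-conjugate ρ (transpose zero (suc zero))) (sgn-transpose₀₁ {n})
  where
  -- ρ 0 = a and ρ 1 = b
  ρ : Permutation′ (suc (suc n))
  ρ = insert zero a (insert zero (punchOut a≢b) idₚ)

module _ {n : ℕ} {ψ : Permutation′ n} {a b : Fin n} (swap : IsSwap ψ a b) where
  open IsSwap swap

  swap-involutive : ∀ j → ψ ⟨$⟩ˡ (ψ ⟨$⟩ˡ j) ≡ j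
  swap-involutive j with j ≟ a | j ≟ b
  ... | yes refl | _        = trans (cong (ψ ⟨$⟩ˡ_) sends-a) sends-b
  ... | no _     | yes refl = trans (cong (ψ ⟨$⟩ˡ_) sends-b) sends-a
  ... | no j≢a   | no j≢b   = trans (cong (ψ ⟨$⟩ˡ_) (fixes-others j≢a j≢b)) (fixes-others j≢a j≢b)

  image-swap-⊆ : ∀ {S} → (a ∈ S → b ∈ S) → (b ∈ S → a ∈ S) → image ψ S ⊆ S
  image-swap-⊆ {S} a→b b→a {j} j∈ψS with ∈-image⁻ ψ j∈ψS | j ≟ a | j ≟ b
  ... | ψj∈S | yes refl | _        = b→a (subst (_∈ S) sends-a ψj∈S)
  ... | ψj∈S | no _     | yes refl = a→b (subst (_∈ S) sends-b ψj∈S)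
  ... | ψj∈S | no j≢a   | no j≢b   = subst (_∈ S) (fixes-others j≢a j≢b) ψj∈S

  image-swap-exchange : ∀ {S} → a ∈ S → b ∉ S → image ψ S ⊆ ⁅ b ⁆ ∪ (S - a)
  image-swap-exchange {S} a∈S b∉S {j} j∈ψS with ∈-image⁻ ψ j∈ψS | j ≟ b | j ≟ a
  ... | _    | yes refl | _        = x∈p∪q⁺ (inj₁ (x∈⁅x⁆ j))
  ... | ψj∈S | no _     | yes refl = ⊥-elim (b∉S (subst (_∈ S) sends-a ψj∈S))
  ... | ψj∈S | no j≢b   | no j≢a   =
    x∈p∪q⁺ (inj₂ (x∈p∧x≢y⇒x∈p-y (subst (_∈ S) (fixes-others j≢a j≢b) ψj∈S) j≢a))

module _ {n : ℕ} (M : Matroid n) where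

  indep-⊆ : ∀ {A B} → A ⊆ B → Indep M B → Indep M A
  indep-⊆ {A} {B} = ind-down M A B

  dependent-⊇ : ∀ {A B} → A ⊆ B → ¬ Indep M A → ¬ Indep M B
  dependent-⊇ A⊆B A-dep = A-dep ∘ indep-⊆ A⊆B

  IsLoop : Fin n → Set
  IsLoop ℓ = ¬ Indep M ⁅ ℓ ⁆

  record Parallel (a b : Fin n) : Set where
    field
      distinct  : a ≢ b
      indep-a   : Indep M ⁅ a ⁆
      indep-b   : Indep M ⁅ b ⁆
      dependent : ¬ Indep M (⁅ a ⁆ ∪ ⁅ b ⁆)

  Parallel-sym : ∀ {a b} → Parallel a b → Parallel b a
  Parallel-sym {a} {b} a∥b = record
    { distinct  = distinct ∘ sym
    ; indep-a   = indep-b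
    ; indep-b   = indep-a
    ; dependent = dependent-⊇ (⁅⁆∪-⊆ (x∈p∪q⁺ (inj₂ (x∈⁅x⁆ a))) (⁅⁆-⊆ (x∈p∪q⁺ (inj₁ (x∈⁅x⁆ b))))) dependent
    }
    where open Parallel a∥b

  small-circuit : ∀ {C} → IsCircuit M C → ∣ C ∣ ≤ 2 → ∃ IsLoop ⊎ ∃₂ Parallel
  small-circuit {C} (C-dep , C-minimal) ∣C∣≤2 with nonempty? C
  ... | no C-empty = ⊥-elim (C-dep (subst (Indep M) (sym (Empty-unique C-empty)) (ind-empty M)))
  ... | yes (a , a∈C) with nonempty? (C - a)
  ...   | no C-a-empty = inj₁ (a , dependent-⊇ (Empty[p-x]⇒p⊆⁅x⁆ C-a-empty) C-dep)
  ...   | yes (b , b∈C-a) with nonempty? (C - a - b)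
  ...     | yes (c , c∈C-a-b) = ⊥-elim (<⇒≱ 2<∣C∣ ∣C∣≤2)
    where
    2<∣C∣ : 2 < ∣ C ∣
    2<∣C∣ = ≤-<-trans (≤-<-trans (≤-<-trans z≤n (x∈p⇒∣p-x∣<∣p∣ c∈C-a-b))
                                 (x∈p⇒∣p-x∣<∣p∣ b∈C-a))
                      (x∈p⇒∣p-x∣<∣p∣ a∈C)
  ...     | no C-a-b-empty = inj₂ (a , b , record
    { distinct  = a≢b
    ; indep-a   = indep-⊆ (⁅⁆-⊆ (x∈p∧x≢y⇒x∈p-y a∈C a≢b)) (C-minimal b b∈C)
    ; indep-b   = indep-⊆ (⁅⁆-⊆ b∈C-a) (C-minimal a a∈C)
    ; dependent = dependent-⊇ (⊆-trans (p⊆⁅x⁆∪p-x C a) (∪-mono id (Empty[p-x]⇒p⊆⁅x⁆ C-a-b-empty))) C-dep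
    })
    where
    a≢b : a ≢ b
    a≢b = x∈p-y⇒x≢y b∈C-a ∘ sym
    b∈C : b ∈ C
    b∈C = x∈p-y⇒x∈p b∈C-a

-- Grow ⁅ y ⁆ ∪ T one element t of S - x at a time: augmenting ⁅ y ⁆ ∪ (T - t) from ⁅ x ⁆ ∪ T
-- can only add t, since adding x would put the parallel pair x, y together.
exchange-parallel : ∀ {n} (M : Matroid n) {x y} → Parallel M x y →
                    ∀ {S} → Indep M S → x ∈ S → y ∉ S → Indep M (⁅ y ⁆ ∪ (S - x))
exchange-parallel {n} M {x} {y} x∥y {S} S-indep x∈S y∉S = grow ∣ S - x ∣ (S - x) ≤-refl id
  where
  open Parallel x∥y
  grow : ∀ k T → ∣ T ∣ ≤ k → T ⊆ S - x → Indep M (⁅ y ⁆ ∪ T)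
  grow k T ∣T∣≤k T⊆S-x with nonempty? T
  ... | no T-empty = indep-⊆ M (⁅⁆∪-⊆ (x∈⁅x⁆ y) (λ t∈T → ⊥-elim (T-empty (_ , t∈T)))) indep-b
  ... | yes (t , t∈T) with k
  ...   | zero  = ⊥-elim (<⇒≱ (x∈p⇒∣p-x∣<∣p∣ t∈T) (≤-trans ∣T∣≤k z≤n))
  ...   | suc k with ind-aug M A B A-indep B-indep ∣A∣<∣B∣
    where
    A B : Subset n
    A = ⁅ y ⁆ ∪ (T - t)
    B = ⁅ x ⁆ ∪ T
    A-indep : Indep M A
    A-indep = grow k (T - t) (≤-pred (≤-trans (x∈p⇒∣p-x∣<∣p∣ t∈T) ∣T∣≤k)) (T⊆S-x ∘ x∈p-y⇒x∈p)
    B-indep : Indep M B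
    B-indep = indep-⊆ M (⁅⁆∪-⊆ x∈S (x∈p-y⇒x∈p ∘ T⊆S-x)) S-indep
    ∣A∣<∣B∣ : ∣ A ∣ < ∣ B ∣
    ∣A∣<∣B∣ = ≤-<-trans (≤-trans (∣⁅x⁆∪p∣≤1+∣p∣ y (T - t)) (x∈p⇒∣p-x∣<∣p∣ t∈T))
                        (x∉p⇒∣p∣<∣⁅x⁆∪p∣ (λ x∈T → x∈p-y⇒x≢y (T⊆S-x x∈T) refl))
  ...     | z , z∈B , z∉A , z∪A-indep = indep-⊆ M (⁅⁆∪-⊆ (y∈z∪A) T⊆z∪A) z∪A-indep
    where
    A : Subset n
    A = ⁅ y ⁆ ∪ (T - t)
    y∈z∪A : y ∈ ⁅ z ⁆ ∪ A
    y∈z∪A = x∈p∪q⁺ (inj₂ (x∈p∪q⁺ (inj₁ (x∈⁅x⁆ y))))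
    z≡t : z ≡ t
    z≡t with x∈p∪q⁻ ⁅ x ⁆ T z∈B | z ≟ t
    ... | _          | yes z≡t = z≡t
    ... | inj₁ z∈⁅x⁆ | no _    = ⊥-elim (dependent (indep-⊆ M
            (⁅⁆∪-⊆ (x∈p∪q⁺ (inj₁ (subst (_∈ ⁅ z ⁆) (x∈⁅y⁆⇒x≡y x z∈⁅x⁆) (x∈⁅x⁆ z)))) (⁅⁆-⊆ y∈z∪A))
            z∪A-indep))
    ... | inj₂ z∈T   | no z≢t  = ⊥-elim (z∉A (x∈p∪q⁺ (inj₂ (x∈p∧x≢y⇒x∈p-y z∈T z≢t))))
    T⊆z∪A : T ⊆ ⁅ z ⁆ ∪ A
    T⊆z∪A = ⊆-trans (p⊆⁅x⁆∪p-x T t)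
                    (∪-mono (⁅⁆-⊆ (subst (_∈ ⁅ z ⁆) z≡t (x∈⁅x⁆ z))) (λ w∈T-t → x∈p∪q⁺ (inj₂ w∈T-t)))

module _ {n : ℕ} (M : Matroid n) where

  involution-automorphism : ∀ {ψ} → (∀ j → ψ ⟨$⟩ˡ (ψ ⟨$⟩ˡ j) ≡ j) →
                            (∀ {S} → Indep M S → Indep M (image ψ S)) → IsIso M M ψ
  involution-automorphism {ψ} involutive preserves S = ⇔→≡ (mk⇔ backward preserves)
    where
    backward : Indep M (image ψ S) → Indep M S
    backward ψS-indep = indep-⊆ M (λ {j} j∈S → ∈-image⁺ ψ (∈-image⁺ ψ (subst (_∈ S) (sym (involutive j)) j∈S)))
                                  (preserves ψS-indep)

  swap-loops-automorphism : ∀ {ψ a b} → IsSwap ψ a b → IsLoop M a → IsLoop M b → IsIso M M ψ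
  swap-loops-automorphism {ψ} swap a-loop b-loop = involution-automorphism {ψ} (swap-involutive swap) preserves
    where
    preserves : ∀ {S} → Indep M S → Indep M (image ψ S)
    preserves {S} S-indep = indep-⊆ M (image-swap-⊆ swap (⊥-elim ∘ avoids a-loop) (⊥-elim ∘ avoids b-loop)) S-indep
      where
      avoids : ∀ {ℓ} → IsLoop M ℓ → ℓ ∉ S
      avoids ℓ-loop ℓ∈S = ℓ-loop (indep-⊆ M (⁅⁆-⊆ ℓ∈S) S-indep)

  swap-parallel-automorphism : ∀ {ψ a b} → IsSwap ψ a b → Parallel M a b → IsIso M M ψ
  swap-parallel-automorphism {ψ} {a} {b} swap a∥b = involution-automorphism {ψ} (swap-involutive swap) preserves
    where
    preserves : ∀ {S} → Indep M S → Indep M (image ψ S)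
    preserves {S} S-indep with a ∈? S | b ∈? S
    ... | yes a∈S | yes b∈S = indep-⊆ M (image-swap-⊆ swap (λ _ → b∈S) (λ _ → a∈S)) S-indep
    ... | no a∉S  | no b∉S  = indep-⊆ M (image-swap-⊆ swap (⊥-elim ∘ a∉S) (⊥-elim ∘ b∉S)) S-indep
    ... | yes a∈S | no b∉S  =
      indep-⊆ M (image-swap-exchange swap a∈S b∉S) (exchange-parallel M a∥b S-indep a∈S b∉S)
    ... | no a∉S  | yes b∈S =
      indep-⊆ M (image-swap-exchange (IsSwap-sym swap) b∈S a∉S)
                (exchange-parallel M (Parallel-sym M a∥b) S-indep b∈S a∉S)

-- [M, η] = ½ ([M, -η] + [M, η]) + ½ ([M, η] - [M, ψ_* η]) when ψ_* η = -η.
odd-automorphism⇒IsZero : ∀ {n} (M : Matroid n) η {ψ} → IsIso M M ψ → sgn ψ ≡ s- → IsZero (gen M η)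
odd-automorphism⇒IsZero M η {ψ} aut odd = (½ , negRel M η) ∷ (½ , isoRel M M ψ aut η) ∷ [] , coefficients
  where
  coefficients : ∀ k → coeff (gen M η) k ≡
    coeff (concatMap (λ p → scale (proj₁ p) (relVec (proj₂ p))) ((½ , negRel M η) ∷ (½ , isoRel M M ψ aut η) ∷ [])) k
  coefficients k rewrite odd with keyEq (key M η) k | keyEq (key M (opposite η)) k
  ... | true  | true  = refl
  ... | true  | false = refl
  ... | false | true  = refl
  ... | false | false = refl

allSubsets-complete : ∀ {n} (S : Subset n) → S ∈ₗ allSubsets n
allSubsets-complete []ᵥ = here refl
allSubsets-complete (true  ∷ S) = ∈-++⁺ˡ (∈-map⁺ (true ∷_) (allSubsets-complete S))
allSubsets-complete {suc n} (false ∷ S) = ∈-++⁺ʳ (map (true ∷_) (allSubsets n)) (∈-map⁺ (false ∷_) (allSubsets-complete S))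

module _ {A : Set} (p : A → Bool) where

  allB-sound : ∀ {xs x} → allB p xs ≡ true → x ∈ₗ xs → p x ≡ true
  allB-sound {y ∷ xs} all (here refl) with p y
  ... | true = refl
  allB-sound {y ∷ xs} all (there x∈xs) with p y
  ... | true = allB-sound all x∈xs

  allB-complete : ∀ xs → (∀ x → p x ≡ true) → allB p xs ≡ true
  allB-complete []       _   = refl
  allB-complete (y ∷ xs) all rewrite all y = allB-complete xs all

infix 4 _≈ₖ_
data _≈ₖ_ : Key → Key → Set where
  ≈ₖ-intro : ∀ {n} {f f′ : Subset n → Bool} {s} → (∀ S → f S ≡ f′ S) → (n , f , s) ≈ₖ (n , f′ , s)

≈ₖ-sym : ∀ {k k′} → k ≈ₖ k′ → k′ ≈ₖ k
≈ₖ-sym (≈ₖ-intro f≗f′) = ≈ₖ-intro (sym ∘ f≗f′)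

≈ₖ-trans : ∀ {k k′ k″} → k ≈ₖ k′ → k′ ≈ₖ k″ → k ≈ₖ k″
≈ₖ-trans (≈ₖ-intro f≗f′) (≈ₖ-intro f′≗f″) = ≈ₖ-intro λ S → trans (f≗f′ S) (f′≗f″ S)

boolEq-sound : ∀ {a b} → boolEq a b ≡ true → a ≡ b
boolEq-sound {true}  {true}  _ = refl
boolEq-sound {false} {false} _ = refl

boolEq-refl : ∀ a → boolEq a a ≡ true
boolEq-refl true  = refl
boolEq-refl false = refl

signEq-sound : ∀ s t → signEq s t ≡ true → s ≡ t
signEq-sound s+ s+ _ = refl
signEq-sound s- s- _ = refl

signEq-refl : ∀ s → signEq s s ≡ true
signEq-refl s+ = refl
signEq-refl s- = refl

keyEq⇒≈ₖ : ∀ k k′ → keyEq k k′ ≡ true → k ≈ₖ k′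
keyEq⇒≈ₖ (n , f , s) (n′ , f′ , s′) eq with n ℕ.≟ n′
... | no _ with () ← eq
... | yes refl with signEq-sound s s′ (∧-conicalʳ _ _ eq)
...   | refl = ≈ₖ-intro λ S →
        boolEq-sound (allB-sound (λ S → boolEq (f S) (f′ S)) (∧-conicalˡ _ _ eq) (allSubsets-complete S))

≈ₖ⇒keyEq : ∀ {k k′} → k ≈ₖ k′ → keyEq k k′ ≡ true
≈ₖ⇒keyEq {n , f , s} {_ , f′ , _} (≈ₖ-intro f≗f′) rewrite ≟-diag {n} refl
  | allB-complete (λ S → boolEq (f S) (f′ S)) (allSubsets n) (λ S → subst (λ b → boolEq (f S) b ≡ true) (f≗f′ S) (boolEq-refl (f S)))
  = signEq-refl s

keyEq-refl : ∀ k → keyEq k k ≡ true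
keyEq-refl k = ≈ₖ⇒keyEq (≈ₖ-intro {f = proj₁ (proj₂ k)} λ _ → refl)

keyEq-congˡ : ∀ k k′ k″ → keyEq k k′ ≡ true → keyEq k k″ ≡ keyEq k′ k″
keyEq-congˡ k k′ k″ k≈k′ = ⇔→≡ (mk⇔
  (λ k≈k″ → ≈ₖ⇒keyEq (≈ₖ-trans (≈ₖ-sym (keyEq⇒≈ₖ k k′ k≈k′)) (keyEq⇒≈ₖ k k″ k≈k″)))
  (λ k′≈k″ → ≈ₖ⇒keyEq (≈ₖ-trans (keyEq⇒≈ₖ k k′ k≈k′) (keyEq⇒≈ₖ k′ k″ k′≈k″))))

evaluate : (Key → ℚ) → Comb → ℚ
evaluate φ = foldr (λ p acc → proj₁ p *ℚ φ (proj₂ p) +ℚ acc) 0ℚ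

indicator : Key → Key → ℚ
indicator k k′ = if keyEq k′ k then 1ℚ else 0ℚ

Respects : (Key → ℚ) → Set
Respects φ = ∀ k k′ → keyEq k k′ ≡ true → φ k ≡ φ k′

dropKey : Key → Comb → Comb
dropKey k₀ = filterᵇ (λ p → not (keyEq (proj₂ p) k₀))

coeff≡evaluate-indicator : ∀ v k → coeff v k ≡ evaluate (indicator k) v
coeff≡evaluate-indicator []            k = refl
coeff≡evaluate-indicator ((q , k′) ∷ v) k = cong₂ _+ℚ_ (select (keyEq k′ k)) (coeff≡evaluate-indicator v k)
  where
  select : ∀ b → (if b then q else 0ℚ) ≡ q *ℚ (if b then 1ℚ else 0ℚ)
  select true  = sym (ℚ.*-identityʳ q)
  select false = sym (ℚ.*-zeroʳ q)

indicator-respects : ∀ k → Respects (indicator k)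
indicator-respects k k₁ k₂ k₁≈k₂ = cong (λ b → if b then 1ℚ else 0ℚ) (keyEq-congˡ k₁ k₂ k k₁≈k₂)

module _ (φ : Key → ℚ) where

  evaluate-++ : ∀ u v → evaluate φ (u ++ v) ≡ evaluate φ u +ℚ evaluate φ v
  evaluate-++ []            v = sym (ℚ.+-identityˡ (evaluate φ v))
  evaluate-++ ((q , k) ∷ u) v = trans (cong (q *ℚ φ k +ℚ_) (evaluate-++ u v))
                                      (sym (ℚ.+-assoc (q *ℚ φ k) (evaluate φ u) (evaluate φ v)))

  evaluate-scale : ∀ c v → evaluate φ (scale c v) ≡ c *ℚ evaluate φ v
  evaluate-scale c []            = sym (ℚ.*-zeroʳ c)
  evaluate-scale c ((q , k) ∷ v) = begin
    c *ℚ q *ℚ φ k +ℚ evaluate φ (scale c v)  ≡⟨ cong₂ _+ℚ_ (ℚ.*-assoc c q (φ k)) (evaluate-scale c v) ⟩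
    c *ℚ (q *ℚ φ k) +ℚ c *ℚ evaluate φ v     ≡⟨ ℚ.*-distribˡ-+ c (q *ℚ φ k) (evaluate φ v) ⟨
    c *ℚ (q *ℚ φ k +ℚ evaluate φ v)          ∎
    where open ≡-Reasoning

  evaluate-dropKey : Respects φ → ∀ k₀ v → evaluate φ v ≡ coeff v k₀ *ℚ φ k₀ +ℚ evaluate φ (dropKey k₀ v)
  evaluate-dropKey resp k₀ [] = sym (trans (ℚ.+-identityʳ _) (ℚ.*-zeroˡ (φ k₀)))
  evaluate-dropKey resp k₀ ((q , k) ∷ v) with keyEq k k₀ in k≈k₀
  ... | true  = begin
    q *ℚ φ k +ℚ evaluate φ v                              ≡⟨ cong₂ (λ x y → q *ℚ x +ℚ y) (resp k k₀ k≈k₀) (evaluate-dropKey resp k₀ v) ⟩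
    q *ℚ φ k₀ +ℚ (coeff v k₀ *ℚ φ k₀ +ℚ E)                ≡⟨ solve 4 (λ q c f e → q :* f :+ (c :* f :+ e) := (q :+ c) :* f :+ e) refl q (coeff v k₀) (φ k₀) E ⟩
    (q +ℚ coeff v k₀) *ℚ φ k₀ +ℚ E                        ∎
    where open ≡-Reasoning
          E : ℚ
          E = evaluate φ (dropKey k₀ v)
  ... | false = begin
    q *ℚ φ k +ℚ evaluate φ v                              ≡⟨ cong (q *ℚ φ k +ℚ_) (evaluate-dropKey resp k₀ v) ⟩
    q *ℚ φ k +ℚ (coeff v k₀ *ℚ φ k₀ +ℚ E)                 ≡⟨ solve 4 (λ x c f e → x :+ (c :* f :+ e) := (con 0ℚ :+ c) :* f :+ (x :+ e)) refl (q *ℚ φ k) (coeff v k₀) (φ k₀) E ⟩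
    (0ℚ +ℚ coeff v k₀) *ℚ φ k₀ +ℚ (q *ℚ φ k +ℚ E)         ∎
    where open ≡-Reasoning
          E : ℚ
          E = evaluate φ (dropKey k₀ v)

-- The terms whose key is equivalent to the first one contribute coeff v k₀ · φ k₀ = 0, and
-- dropping them leaves a shorter combination whose coefficients still all vanish.
evaluate-null : ∀ φ → Respects φ → ∀ v → (∀ k → coeff v k ≡ 0ℚ) → evaluate φ v ≡ 0ℚ
evaluate-null φ resp v = go (length v) v ≤-refl
  where
  go : ∀ n v → length v ≤ n → (∀ k → coeff v k ≡ 0ℚ) → evaluate φ v ≡ 0ℚ
  go _       []                 _             _    = refl
  go (suc n) v@((_ , k₀) ∷ rest) (s≤s ∣rest∣≤n) null = begin
    evaluate φ v                                    ≡⟨ evaluate-dropKey φ resp k₀ v ⟩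
    coeff v k₀ *ℚ φ k₀ +ℚ evaluate φ (dropKey k₀ v) ≡⟨ cong₂ (λ c e → c *ℚ φ k₀ +ℚ e) (null k₀) (go n (dropKey k₀ v) shorter dropped-null) ⟩
    0ℚ *ℚ φ k₀ +ℚ 0ℚ                                ≡⟨ solve 1 (λ f → con 0ℚ :* f :+ con 0ℚ := con 0ℚ) refl (φ k₀) ⟩
    0ℚ                                              ∎
    where
    open ≡-Reasoning
    shorter : length (dropKey k₀ v) ≤ n
    shorter rewrite keyEq-refl k₀ = ≤-trans (length-filter _ rest) ∣rest∣≤n
    dropped-null : ∀ k → coeff (dropKey k₀ v) k ≡ 0ℚ
    dropped-null k = begin
      coeff (dropKey k₀ v) k                          ≡⟨ coeff≡evaluate-indicator (dropKey k₀ v) k ⟩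
      E                                               ≡⟨ solve 2 (λ c e → e := con 0ℚ :* c :+ e) refl (indicator k k₀) E ⟩
      0ℚ *ℚ indicator k k₀ +ℚ E                       ≡⟨ cong (λ c → c *ℚ indicator k k₀ +ℚ E) (null k₀) ⟨
      coeff v k₀ *ℚ indicator k k₀ +ℚ E               ≡⟨ evaluate-dropKey (indicator k) (indicator-respects k) k₀ v ⟨
      evaluate (indicator k) v                        ≡⟨ coeff≡evaluate-indicator v k ⟨
      coeff v k                                       ≡⟨ null k ⟩
      0ℚ                                              ∎
      where E = evaluate (indicator k) (dropKey k₀ v)

evaluate-coeff : ∀ φ → Respects φ → ∀ u v → (∀ k → coeff u k ≡ coeff v k) → evaluate φ u ≡ evaluate φ v
evaluate-coeff φ resp u v u≗v = begin
  evaluate φ u                                  ≡⟨ solve 2 (λ a b → a := (a :+ con (- 1ℚ) :* b) :+ b) refl (evaluate φ u) (evaluate φ v) ⟩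
  (evaluate φ u +ℚ - 1ℚ *ℚ evaluate φ v) +ℚ evaluate φ v  ≡⟨ cong (_+ℚ evaluate φ v) (trans (sym (linear φ)) (evaluate-null φ resp d d-null)) ⟩
  0ℚ +ℚ evaluate φ v                            ≡⟨ ℚ.+-identityˡ (evaluate φ v) ⟩
  evaluate φ v                                  ∎
  where
  open ≡-Reasoning
  d : Comb
  d = u ++ scale (- 1ℚ) v
  linear : ∀ ψ → evaluate ψ d ≡ evaluate ψ u +ℚ - 1ℚ *ℚ evaluate ψ v
  linear ψ = trans (evaluate-++ ψ u _) (cong (evaluate ψ u +ℚ_) (evaluate-scale ψ (- 1ℚ) v))
  d-null : ∀ k → coeff d k ≡ 0ℚ
  d-null k = begin
    coeff d k                                               ≡⟨ coeff≡evaluate-indicator d k ⟩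
    evaluate (indicator k) d                                ≡⟨ linear (indicator k) ⟩
    evaluate (indicator k) u +ℚ - 1ℚ *ℚ evaluate (indicator k) v
      ≡⟨ cong₂ (λ a b → a +ℚ - 1ℚ *ℚ b) (coeff≡evaluate-indicator u k) (coeff≡evaluate-indicator v k) ⟨
    coeff u k +ℚ - 1ℚ *ℚ coeff v k                          ≡⟨ cong (λ a → a +ℚ - 1ℚ *ℚ coeff v k) (u≗v k) ⟩
    coeff v k +ℚ - 1ℚ *ℚ coeff v k                          ≡⟨ solve 1 (λ a → a :+ con (- 1ℚ) :* a := con 0ℚ) refl (coeff v k) ⟩
    0ℚ                                                      ∎

combination : List (ℚ × Rel) → Comb
combination = concatMap (λ p → scale (proj₁ p) (relVec (proj₂ p)))

evaluate-IsZero : ∀ φ → Respects φ → (∀ r → evaluate φ (relVec r) ≡ 0ℚ) → ∀ v → IsZero v → evaluate φ v ≡ 0ℚ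
evaluate-IsZero φ resp rel-null v (rs , v≗rs) = trans (evaluate-coeff φ resp v (combination rs) v≗rs) (relations rs)
  where
  relations : ∀ rs → evaluate φ (combination rs) ≡ 0ℚ
  relations []             = refl
  relations ((q , r) ∷ rs) = begin
    evaluate φ (scale q (relVec r) ++ combination rs)                ≡⟨ evaluate-++ φ (scale q (relVec r)) (combination rs) ⟩
    evaluate φ (scale q (relVec r)) +ℚ evaluate φ (combination rs)  ≡⟨ cong₂ _+ℚ_ (evaluate-scale φ q (relVec r)) (relations rs) ⟩
    q *ℚ evaluate φ (relVec r) +ℚ 0ℚ                                ≡⟨ cong (λ e → q *ℚ e +ℚ 0ℚ) (rel-null r) ⟩
    q *ℚ 0ℚ +ℚ 0ℚ                                                   ≡⟨ solve 1 (λ q → q :* con 0ℚ :+ con 0ℚ := con 0ℚ) refl q ⟩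
    0ℚ                                                              ∎
    where open ≡-Reasoning

∑ℚ-delta : ∀ {n} (t : Fin (suc n) → ℚ) ℓ → (∀ i → t (punchIn ℓ i) ≡ 0ℚ) → ∑ℚ.sum t ≡ t ℓ
∑ℚ-delta {n} t ℓ vanishes = begin
  ∑ℚ.sum t                              ≡⟨ ∑ℚ.sum-remove {i = ℓ} t ⟩
  t ℓ +ℚ ∑ℚ.sum (t ∘ punchIn ℓ)         ≡⟨ cong (t ℓ +ℚ_) (trans (∑ℚ.sum-cong-≗ vanishes) (∑ℚ.sum-replicate-zero n)) ⟩
  t ℓ +ℚ 0ℚ                             ≡⟨ ℚ.+-identityʳ (t ℓ) ⟩
  t ℓ                                   ∎
  where open ≡-Reasoning

evaluate-map-filter : ∀ φ {A : Set} (h : A → Key) {P : A → Set} (P? : Decidable P) {k} (t : Fin k → A) →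
  evaluate φ (map (λ x → (1ℚ , h x)) (filter P? (List.tabulate t)))
    ≡ ∑ℚ.sum (λ i → if does (P? (t i)) then 1ℚ *ℚ φ (h (t i)) else 0ℚ)
evaluate-map-filter φ h P? {zero}  t = refl
evaluate-map-filter φ h P? {suc k} t with does (P? (t zero))
... | true  = cong (1ℚ *ℚ φ (h (t zero)) +ℚ_) (evaluate-map-filter φ h P? (t ∘ suc))
... | false = trans (evaluate-map-filter φ h P? (t ∘ suc)) (sym (ℚ.+-identityˡ _))

perms : ∀ m → List (Permutation′ m)
perms zero    = idₚ ∷ []
perms (suc m) = concatMap (λ j → map (insert zero j) (perms m)) (allFin (suc m))

perms-complete : ∀ {m} (π : Permutation′ m) → ∃ λ π′ → π′ ∈ₗ perms m × π′ ≈ π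
perms-complete {zero}  π = idₚ , here refl , λ ()
perms-complete {suc m} π with perms-complete (remove zero π)
... | π′ , π′∈perms , π′≈π = insert zero π₀ π′ ,
  ∈-concatMap⁺ (λ j → map (insert zero j) (perms m)) (lose (∈-allFin π₀) (∈-map⁺ (insert zero π₀) π′∈perms)) ,
  λ k → trans (insert-cong k) (insert-remove zero π k)
  where
  π₀ : Fin (suc m)
  π₀ = π ⟨$⟩ʳ zero
  insert-cong : insert zero π₀ π′ ≈ insert zero π₀ (remove zero π)
  insert-cong zero    = refl
  insert-cong (suc k) = cong (punchIn π₀) (π′≈π k)

∀-Subset? : ∀ {n} {P : Subset n → Set} → Decidable P → Dec (∀ S → P S)
∀-Subset? P? = map′ (λ ¬∃¬P S → decidable-stable (P? S) (λ ¬PS → ¬∃¬P (S , ¬PS)))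
                    (λ ∀P (S , ¬PS) → ¬PS (∀P S))
                    (¬? (anySubset? (¬? ∘ P?)))

signℚ : Sign → ℚ
signℚ s+ = 1ℚ
signℚ s- = - 1ℚ

signℚ≢0 : ∀ s → signℚ s ≢ 0ℚ
signℚ≢0 s+ ()
signℚ≢0 s- ()

-- φ [M, η] = η · sgn π if M ≅ g via π, and 0 if M ≇ g; the absence of odd automorphisms
-- of g makes the sign independent of π, so φ vanishes on the relations of 𝓜.
module CoefficientOf {m : ℕ} (g : Subset m → Bool) (g-no-odd : NoOddAutomorphism g) where

  iso? : ∀ f → Dec (∃ λ π → f ≅⟨ π ⟩ g)
  iso? f = map′ satisfied
    (λ (π , f≅g) → let (π′ , π′∈perms , π′≈π) = perms-complete π in
                   lose π′∈perms (≅-≈ {f = f} {g} {π} {π′} (sym ∘ π′≈π) f≅g))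
    (any? (λ π → ∀-Subset? λ S → g (image π S) Bool.≟ f S) (perms m))

  signed : ∀ {f} → Dec (∃ λ π → f ≅⟨ π ⟩ g) → Sign → ℚ
  signed (yes (π , _)) s = signℚ (s *ₛ sgn π)
  signed (no _)        _ = 0ℚ

  at : ∀ {n} → Dec (n ≡ m) → (Subset n → Bool) → Sign → ℚ
  at (yes refl) f s = signed (iso? f) s
  at (no _)     _ _ = 0ℚ

  φ : Key → ℚ
  φ (n , f , s) = at (n ℕ.≟ m) f s

  φ-at-m : ∀ f s → φ (m , f , s) ≡ signed (iso? f) s
  φ-at-m f s = cong (λ d → at d f s) (≟-diag refl)

  signed-≅ : ∀ {f f′ ψ} → f ≅⟨ ψ ⟩ f′ → ∀ η d d′ → signed {f} d η ≡ signed {f′} d′ (sgn ψ *ₛ η)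
  signed-≅ {f} {f′} {ψ} f≅f′ η (yes (π , f≅g)) (yes (π′ , f′≅g)) = cong signℚ (begin
    η *ₛ sgn π                              ≡⟨ cancel (sgn ψ) η (sgn π) ⟩
    (sgn ψ *ₛ η) *ₛ (sgn ψ *ₛ sgn π)        ≡⟨ cong (λ s → (sgn ψ *ₛ η) *ₛ (s *ₛ sgn π)) (sgn-flip ψ) ⟨
    (sgn ψ *ₛ η) *ₛ (sgn (flip ψ) *ₛ sgn π) ≡⟨ cong ((sgn ψ *ₛ η) *ₛ_) (sgn-∘ (flip ψ) π) ⟨
    (sgn ψ *ₛ η) *ₛ sgn (flip ψ ∘ₚ π)       ≡⟨ cong ((sgn ψ *ₛ η) *ₛ_) (≅-sgn-unique g-no-odd {π = flip ψ ∘ₚ π} {π′} (≅-trans {f = f′} {f} {g} {flip ψ} {π} (≅-sym {π = ψ} f≅f′) f≅g) f′≅g) ⟩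
    (sgn ψ *ₛ η) *ₛ sgn π′                  ∎)
    where
    open ≡-Reasoning
    cancel : ∀ s η t → η *ₛ t ≡ (s *ₛ η) *ₛ (s *ₛ t)
    cancel s+ η t = refl
    cancel s- s+ s+ = refl
    cancel s- s+ s- = refl
    cancel s- s- s+ = refl
    cancel s- s- s- = refl
  signed-≅ {f} {f′} {ψ} f≅f′ η (yes (π , f≅g)) (no f′≇g) =
    ⊥-elim (f′≇g (flip ψ ∘ₚ π , ≅-trans {f = f′} {f} {g} {flip ψ} {π} (≅-sym {π = ψ} f≅f′) f≅g))
  signed-≅ {f} {f′} {ψ} f≅f′ η (no f≇g) (yes (π′ , f′≅g)) =
    ⊥-elim (f≇g (ψ ∘ₚ π′ , ≅-trans {f = f} {f′} {g} {ψ} {π′} f≅f′ f′≅g))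
  signed-≅ f≅f′ η (no _) (no _) = refl

  φ-≅ : ∀ {n} {f f′ : Subset n → Bool} {ψ} → f ≅⟨ ψ ⟩ f′ → ∀ η → φ (n , f , η) ≡ φ (n , f′ , sgn ψ *ₛ η)
  φ-≅ {n} {f} {f′} {ψ} f≅f′ η with n ℕ.≟ m
  ... | yes refl = signed-≅ {f} {f′} {ψ} f≅f′ η (iso? f) (iso? f′)
  ... | no _     = refl

  φ-respects : Respects φ
  φ-respects k k′ k≈k′ with keyEq⇒≈ₖ k k′ k≈k′
  ... | ≈ₖ-intro {n} {f} {f′} {s} f≗f′ =
    trans (φ-≅ {ψ = idₚ} (≅-refl f≗f′) s) (cong (λ t → φ (n , f′ , t *ₛ s)) (sgn-id {n}))

  φ-opposite : ∀ {n} (f : Subset n → Bool) s → φ (n , f , opposite s) +ℚ φ (n , f , s) ≡ 0ℚ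
  φ-opposite {n} f s with n ℕ.≟ m
  ... | no _     = refl
  ... | yes refl with iso? f
  ...   | no _        = refl
  ...   | yes (π , _) with s | sgn π
  ...     | s+ | s+ = refl
  ...     | s+ | s- = refl
  ...     | s- | s+ = refl
  ...     | s- | s- = refl

  φ-relVec : ∀ r → evaluate φ (relVec r) ≡ 0ℚ
  φ-relVec (negRel M η) = begin
    1ℚ *ℚ φ (key M (opposite η)) +ℚ (1ℚ *ℚ φ (key M η) +ℚ 0ℚ)
      ≡⟨ solve 2 (λ a b → con 1ℚ :* a :+ (con 1ℚ :* b :+ con 0ℚ) := a :+ b) refl (φ (key M (opposite η))) (φ (key M η)) ⟩
    φ (key M (opposite η)) +ℚ φ (key M η)
      ≡⟨ φ-opposite (indep M) η ⟩
    0ℚ ∎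
    where open ≡-Reasoning
  φ-relVec (isoRel M M′ ψ iso η) = begin
    1ℚ *ℚ φ (key M η) +ℚ (- 1ℚ *ℚ φ (key M′ (sgn ψ *ₛ η)) +ℚ 0ℚ)
      ≡⟨ cong (λ a → 1ℚ *ℚ a +ℚ (- 1ℚ *ℚ φ (key M′ (sgn ψ *ₛ η)) +ℚ 0ℚ)) (φ-≅ {ψ = ψ} iso η) ⟩
    1ℚ *ℚ φ (key M′ (sgn ψ *ₛ η)) +ℚ (- 1ℚ *ℚ φ (key M′ (sgn ψ *ₛ η)) +ℚ 0ℚ)
      ≡⟨ solve 1 (λ a → con 1ℚ :* a :+ (con (- 1ℚ) :* a :+ con 0ℚ) := con 0ℚ) refl (φ (key M′ (sgn ψ *ₛ η))) ⟩
    0ℚ ∎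
    where open ≡-Reasoning

  φ-self : ∀ s → φ (m , g , s) ≢ 0ℚ
  φ-self s rewrite φ-at-m g s with iso? g
  ... | yes (π , _) = signℚ≢0 (s *ₛ sgn π)
  ... | no g≇g      = ⊥-elim (g≇g (idₚ , ≅-refl (λ _ → refl)))

  φ-non-isomorphic : ∀ {f} → (∀ π → ¬ f ≅⟨ π ⟩ g) → ∀ s → φ (m , f , s) ≡ 0ℚ
  φ-non-isomorphic {f} f≇g s rewrite φ-at-m f s with iso? f
  ... | yes (π , f≅g) = ⊥-elim (f≇g π f≅g)
  ... | no _          = refl

⊆ᵇ⇒∣∣≤ : ∀ {n} (A B : Subset n) → (A ⊆ᵇ B) ≡ true → ∣ A ∣ ≤ ∣ B ∣
⊆ᵇ⇒∣∣≤ []ᵥ          []ᵥ          _   = z≤n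
⊆ᵇ⇒∣∣≤ (true  ∷ A) (true  ∷ B) A⊆B = s≤s (⊆ᵇ⇒∣∣≤ A B A⊆B)
⊆ᵇ⇒∣∣≤ (false ∷ A) (true  ∷ B) A⊆B = m≤n⇒m≤1+n (⊆ᵇ⇒∣∣≤ A B A⊆B)
⊆ᵇ⇒∣∣≤ (false ∷ A) (false ∷ B) A⊆B = ⊆ᵇ⇒∣∣≤ A B A⊆B

⊆ᵇ-∣∣-antisym : ∀ {n} (A B : Subset n) → (A ⊆ᵇ B) ≡ true → ∣ B ∣ ≤ ∣ A ∣ → (B ⊆ᵇ A) ≡ true
⊆ᵇ-∣∣-antisym []ᵥ          []ᵥ          _   _          = refl
⊆ᵇ-∣∣-antisym (true  ∷ A) (true  ∷ B) A⊆B (s≤s ∣B∣≤∣A∣) = ⊆ᵇ-∣∣-antisym A B A⊆B ∣B∣≤∣A∣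
⊆ᵇ-∣∣-antisym (false ∷ A) (false ∷ B) A⊆B ∣B∣≤∣A∣       = ⊆ᵇ-∣∣-antisym A B A⊆B ∣B∣≤∣A∣
⊆ᵇ-∣∣-antisym (false ∷ A) (true  ∷ B) A⊆B ∣B∣≤∣A∣       = ⊥-elim (<⇒≱ ∣B∣≤∣A∣ (⊆ᵇ⇒∣∣≤ A B A⊆B))

module _ {n : ℕ} (M : Matroid n) where

  private
    weight : Subset n → ℕ
    weight S = if indep M S then suc ∣ S ∣ else 0

  largest-indep : Subset n
  largest-indep = argmax weight ⊥ (allSubsets n)

  largest-indep-indep : Indep M largest-indep
  largest-indep-indep with indep M largest-indep | positive
    where
    positive : 1 ≤ weight largest-indep
    positive = ≤-trans (subst (λ b → 1 ≤ (if b then suc ∣ ⊥ {n = n} ∣ else 0)) (sym (ind-empty M)) (s≤s z≤n))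
                       (f[⊥]≤f[argmax] {f = weight} ⊥ (allSubsets n))
  ... | true  | _  = refl
  ... | false | ()

  largest-indep-largest : ∀ A → Indep M A → ∣ A ∣ ≤ ∣ largest-indep ∣
  largest-indep-largest A A-indep with All.lookup (f[xs]≤f[argmax] {f = weight} ⊥ (allSubsets n)) (allSubsets-complete A)
  ... | weights rewrite A-indep | largest-indep-indep = ≤-pred weights

  largest-indep-basis : isBasisᵇ (indep M) largest-indep ≡ true
  largest-indep-basis rewrite largest-indep-indep = allB-complete _ (allSubsets n) maximal
    where
    maximal : ∀ A → not (largest-indep ⊆ᵇ A ∧ indep M A) ∨ (A ⊆ᵇ largest-indep) ≡ true
    maximal A with largest-indep ⊆ᵇ A in B⊆A | indep M A in A-indep
    ... | false | _     = refl
    ... | true  | false = refl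
    ... | true  | true  = ⊆ᵇ-∣∣-antisym largest-indep A B⊆A (largest-indep-largest A A-indep)

  loop-not-coloop : ∀ {ℓ} → IsLoop M ℓ → isColoopᵇ (indep M) ℓ ≡ false
  loop-not-coloop {ℓ} ℓ-loop = ¬-not λ coloop → ℓ-loop (indep-⊆ M (⁅⁆-⊆ (ℓ∈basis coloop)) largest-indep-indep)
    where
    ℓ∈basis : isColoopᵇ (indep M) ℓ ≡ true → ℓ ∈ largest-indep
    ℓ∈basis coloop = lookup⇒[]= ℓ largest-indep
      (subst (λ b → not b ∨ lookup largest-indep ℓ ≡ true) largest-indep-basis
             (allB-sound (λ B → not (isBasisᵇ (indep M) B) ∨ lookup B ℓ) coloop (allSubsets-complete largest-indep)))

∈-insertAt⁺ : ∀ {n} {S : Subset n} {i} x → i ∈ S → punchIn x i ∈ insertAt S x false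
∈-insertAt⁺ {S = S} {i} x i∈S = lookup⇒[]= (punchIn x i) _ (trans (insertAt-punchIn S x false i) ([]=⇒lookup i∈S))

∈-insertAt⁻ : ∀ {n} {S : Subset n} {x j} → j ∈ insertAt S x false → ∃ λ i → j ≡ punchIn x i × i ∈ S
∈-insertAt⁻ {n} {S} {x} {j} j∈ with j ≟ x
... | yes refl with () ← trans (sym ([]=⇒lookup j∈)) (insertAt-lookup S j false)
... | no j≢x = i , sym j≡x↑i , lookup⇒[]= i S (begin
  lookup S i                            ≡⟨ insertAt-punchIn S x false i ⟨
  lookup (insertAt S x false) (punchIn x i) ≡⟨ cong (lookup (insertAt S x false)) j≡x↑i ⟩
  lookup (insertAt S x false) j         ≡⟨ []=⇒lookup j∈ ⟩
  true                                  ∎)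
  where
  open ≡-Reasoning
  i : Fin n
  i = punchOut (j≢x ∘ sym)
  j≡x↑i : punchIn x i ≡ j
  j≡x↑i = punchIn-punchOut (j≢x ∘ sym)

lookup-removeAt : ∀ {A : Set} {n} (xs : Vec A (suc n)) ℓ i → lookup (removeAt xs ℓ) i ≡ lookup xs (punchIn ℓ i)
lookup-removeAt xs ℓ i = trans (cong (lookup (removeAt xs ℓ)) (sym (punchOut-punchIn ℓ)))
                               (removeAt-punchOut xs (punchInᵢ≢i ℓ i ∘ sym))

punchIn-ext : ∀ {A : Set} {n} ℓ {u v : Vec A (suc n)} → lookup u ℓ ≡ lookup v ℓ →
              (∀ i → lookup u (punchIn ℓ i) ≡ lookup v (punchIn ℓ i)) → u ≡ v
punchIn-ext ℓ {u} {v} at-ℓ elsewhere =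
  trans (sym (tabulate∘lookup u)) (trans (tabulate-cong pointwise) (tabulate∘lookup v))
  where
  pointwise : ∀ j → lookup u j ≡ lookup v j
  pointwise j with j ≟ ℓ
  ... | yes refl = at-ℓ
  ... | no j≢ℓ   = subst (λ j → lookup u j ≡ lookup v j) (punchIn-punchOut (j≢ℓ ∘ sym)) (elsewhere _)

module _ {m : ℕ} (M : Matroid (suc m)) {ℓ : Fin (suc m)} (ℓ-loop : IsLoop M ℓ) where

  private
    f : Subset (suc m) → Bool
    f = indep M

  dependent-∋ℓ : ∀ {S} → ℓ ∈ S → f S ≡ false
  dependent-∋ℓ ℓ∈S = ¬-not (dependent-⊇ M (⁅⁆-⊆ ℓ∈S) ℓ-loop)

  deletion-loopless : (∀ {z} → z ≢ ℓ → Indep M ⁅ z ⁆) → ∀ z → delIndep ℓ f ⁅ z ⁆ ≡ true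
  deletion-loopless others z = indep-⊆ M inserted⊆ (others (punchInᵢ≢i ℓ z))
    where
    inserted⊆ : insertAt ⁅ z ⁆ ℓ false ⊆ ⁅ punchIn ℓ z ⁆
    inserted⊆ j∈ with ∈-insertAt⁻ j∈
    ... | i , refl , i∈⁅z⁆ = subst (λ i → punchIn ℓ i ∈ ⁅ punchIn ℓ z ⁆) (sym (x∈⁅y⁆⇒x≡y z i∈⁅z⁆)) (x∈⁅x⁆ _)

  deletion-keeps-loop : ∀ {x} (x≢ℓ : x ≢ ℓ) → delIndep x f ⁅ punchOut x≢ℓ ⁆ ≡ false
  deletion-keeps-loop {x} x≢ℓ =
    dependent-∋ℓ (subst (_∈ insertAt ⁅ y ⁆ x false) (punchIn-punchOut x≢ℓ) (∈-insertAt⁺ x (x∈⁅x⁆ y)))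
    where y = punchOut x≢ℓ

  deletion-≇ : (∀ {z} → z ≢ ℓ → Indep M ⁅ z ⁆) → ∀ {x} → x ≢ ℓ → ∀ π → ¬ (delIndep x f ≅⟨ π ⟩ delIndep ℓ f)
  deletion-≇ others {x} x≢ℓ π iso = case true≡false of λ ()
    where
    y : Fin m
    y = punchOut x≢ℓ
    true≡false : true ≡ false
    true≡false = begin
      true                              ≡⟨ deletion-loopless others (π ⟨$⟩ʳ y) ⟨
      delIndep ℓ f ⁅ π ⟨$⟩ʳ y ⁆          ≡⟨ cong (delIndep ℓ f) (image-⁅⁆ π y) ⟨
      delIndep ℓ f (image π ⁅ y ⁆)      ≡⟨ iso ⁅ y ⁆ ⟩
      delIndep x f ⁅ y ⁆                ≡⟨ deletion-keeps-loop x≢ℓ ⟩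
      false                             ∎
      where open ≡-Reasoning

  -- An automorphism σ of M ∖ ℓ extends to M by fixing ℓ; relabelling ℓ as 0 this is lift₀ σ.
  deletion-no-odd : NoOddAutomorphism f → NoOddAutomorphism (delIndep ℓ f)
  deletion-no-odd no-odd σ σ-aut = trans (sym (trans (sgn-conjugate ρ (lift₀ σ)) (sgn-lift₀ σ))) (no-odd ψ extended)
    where
    ρ ψ : Permutation′ (suc m)
    ρ = insert zero ℓ idₚ
    ψ = conjugate ρ (lift₀ σ)
    image-ψ : ∀ T → image ψ T ≡ insertAt (image σ (removeAt T ℓ)) ℓ (lookup T ℓ)
    image-ψ T = punchIn-ext ℓ
      (trans (lookup∘tabulate (λ j → lookup T (ψ ⟨$⟩ˡ j)) ℓ) (trans (cong (lookup T) (conjugate-ˡ ρ (lift₀ σ) zero))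
                                          (sym (insertAt-lookup _ ℓ _))))
      λ i → begin
        lookup (image ψ T) (punchIn ℓ i)        ≡⟨ lookup∘tabulate (λ j → lookup T (ψ ⟨$⟩ˡ j)) (punchIn ℓ i) ⟩
        lookup T (ψ ⟨$⟩ˡ punchIn ℓ i)           ≡⟨ cong (lookup T) (conjugate-ˡ ρ (lift₀ σ) (suc i)) ⟩
        lookup T (punchIn ℓ (σ ⟨$⟩ˡ i))          ≡⟨ lookup-removeAt T ℓ (σ ⟨$⟩ˡ i) ⟨
        lookup (removeAt T ℓ) (σ ⟨$⟩ˡ i)         ≡⟨ lookup∘tabulate (λ j → lookup (removeAt T ℓ) (σ ⟨$⟩ˡ j)) i ⟨
        lookup (image σ (removeAt T ℓ)) i        ≡⟨ insertAt-punchIn _ ℓ _ i ⟨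
        lookup (insertAt (image σ (removeAt T ℓ)) ℓ (lookup T ℓ)) (punchIn ℓ i) ∎
      where open ≡-Reasoning
    on-insertAt : ∀ T b → f (insertAt (image σ T) ℓ b) ≡ f (insertAt T ℓ b)
    on-insertAt T false = σ-aut T
    on-insertAt T true  = trans (dependent-∋ℓ ℓ∈) (sym (dependent-∋ℓ ℓ∈))
      where
      ℓ∈ : ∀ {S} → ℓ ∈ insertAt S ℓ true
      ℓ∈ {S} = lookup⇒[]= ℓ _ (insertAt-lookup S ℓ true)
    extended : f ≅⟨ ψ ⟩ f
    extended T = begin
      f (image ψ T)                                           ≡⟨ cong f (image-ψ T) ⟩
      f (insertAt (image σ (removeAt T ℓ)) ℓ (lookup T ℓ))    ≡⟨ on-insertAt (removeAt T ℓ) (lookup T ℓ) ⟩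
      f (insertAt (removeAt T ℓ) ℓ (lookup T ℓ))              ≡⟨ cong f (insertAt-removeAt T ℓ) ⟩
      f T                                                     ∎
      where open ≡-Reasoning

only-loop⇒∂del-nonzero : ∀ {n} (M : Matroid n) {ℓ} → IsLoop M ℓ → (∀ {z} → z ≢ ℓ → Indep M ⁅ z ⁆) →
                         NoOddAutomorphism (indep M) → ∀ η → ¬ IsZero (∂del M η)
only-loop⇒∂del-nonzero {suc m} M {ℓ} ℓ-loop others no-odd η ∂zero = φ-self s (begin
  φ (m , g , s)                                       ≡⟨ ℚ.*-identityˡ _ ⟨
  1ℚ *ℚ φ (m , g , s)                                 ≡⟨ cong (λ b → if b then 1ℚ *ℚ φ (m , g , s) else 0ℚ) ℓ-kept ⟨
  term ℓ                                              ≡⟨ ∑ℚ-delta term ℓ other-terms ⟨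
  ∑ℚ.sum term                                         ≡⟨ evaluate-map-filter φ deletion P? id ⟨
  evaluate φ (∂del M η)                               ≡⟨ evaluate-IsZero φ φ-respects φ-relVec (∂del M η) ∂zero ⟩
  0ℚ                                                  ∎)
  where
  open ≡-Reasoning
  f : Subset (suc m) → Bool
  f = indep M
  g : Subset m → Bool
  g = delIndep ℓ f
  open CoefficientOf g (deletion-no-odd M ℓ-loop no-odd)
  s : Sign
  s = signPow (toℕ ℓ) *ₛ η
  deletion : Fin (suc m) → Key
  deletion x = (m , delIndep x f , signPow (toℕ x) *ₛ η)
  P? : Decidable (λ x → not (isColoopᵇ f x) ≡ true)
  P? x = not (isColoopᵇ f x) Bool.≟ true
  term : Fin (suc m) → ℚ
  term x = if does (P? x) then 1ℚ *ℚ φ (deletion x) else 0ℚ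
  ℓ-kept : does (P? ℓ) ≡ true
  ℓ-kept rewrite loop-not-coloop M ℓ-loop = refl
  other-terms : ∀ i → term (punchIn ℓ i) ≡ 0ℚ
  other-terms i = vanishing (does (P? (punchIn ℓ i)))
    (φ-non-isomorphic (deletion-≇ M ℓ-loop others (punchInᵢ≢i ℓ i)) (signPow (toℕ (punchIn ℓ i)) *ₛ η))
    where
    vanishing : ∀ b {a} → a ≡ 0ℚ → (if b then 1ℚ *ℚ a else 0ℚ) ≡ 0ℚ
    vanishing true  refl = ℚ.*-zeroʳ 1ℚ
    vanishing false _    = refl

nonzero⇒no-odd-automorphism : ∀ {n} (M : Matroid n) η → ¬ IsZero (gen M η) → NoOddAutomorphism (indep M)
nonzero⇒no-odd-automorphism M η nonzero ψ aut with sgn ψ in sgnψ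
... | s+ = refl
... | s- = ⊥-elim (nonzero (odd-automorphism⇒IsZero M η {ψ} aut sgnψ))

no-swap-automorphism : ∀ {n} {f : Subset n → Bool} → NoOddAutomorphism f →
                       ∀ {a b} → a ≢ b → ¬ (∀ {ψ} → IsSwap ψ a b → f ≅⟨ ψ ⟩ f)
no-swap-automorphism no-odd a≢b swap-aut with odd-swap a≢b
... | ψ , swap , odd with () ← trans (sym odd) (no-odd ψ (swap-aut swap))

another-loop? : ∀ {n} (M : Matroid n) ℓ → (∃ λ z → z ≢ ℓ × IsLoop M z) ⊎ (∀ {z} → z ≢ ℓ → Indep M ⁅ z ⁆)
another-loop? M ℓ with Data.Fin.Properties.any? (λ z → ¬? (z ≟ ℓ) ×-dec ¬? (indep M ⁅ z ⁆ Bool.≟ true))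
... | yes (z , z≢ℓ , z-loop) = inj₁ (z , z≢ℓ , z-loop)
... | no no-other = inj₂ λ {z} z≢ℓ → decidable-stable (indep M ⁅ z ⁆ Bool.≟ true) (λ z-loop → no-other (z , z≢ℓ , z-loop))

lemma6p5 : ∀ (n : ℕ) (M : Matroid n) (η : Sign) →
           ¬ IsZero (gen M η) → IsZero (∂del M η) → Simple M
lemma6p5 n M η nonzero ∂zero C C-circuit = ≰⇒> λ ∣C∣≤2 → case small-circuit M C-circuit ∣C∣≤2 of λ where
    (inj₂ (a , b , a∥b)) → no-odd-swap (Parallel.distinct a∥b) (λ swap → swap-parallel-automorphism M swap a∥b)
    (inj₁ (ℓ , ℓ-loop)) → case another-loop? M ℓ of λ where
      (inj₁ (z , z≢ℓ , z-loop)) → no-odd-swap z≢ℓ (λ swap → swap-loops-automorphism M swap z-loop ℓ-loop)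
      (inj₂ others)             → only-loop⇒∂del-nonzero M ℓ-loop others no-odd η ∂zero
  where
  no-odd : NoOddAutomorphism (indep M)
  no-odd = nonzero⇒no-odd-automorphism M η nonzero
  no-odd-swap : ∀ {a b} → a ≢ b → ¬ (∀ {ψ} → IsSwap ψ a b → IsIso M M ψ)
  no-odd-swap = no-swap-automorphism no-odd
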